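{- The problem $\overline{R}(R(\Pi))$ is equivalent to $\Pi$; that is, up to a renaming of labels, $\overline{R}(R(\Pi)) = \Pi$, so $\Pi$ is a fixed point of round elimination.
   Context: Setting: problems on $\Delta$-regular, $r$-uniform linear hypertrees in the round elimination framework. A problem is a triple (label set, node constraint = set of multisets of $\Delta$ labels, hyperedge constraint = set of multisets of $r$ labels); each node outputs a label on each incident (node, hyperedge) pair. Here $\Delta \ge 2$. Let $\mathfrak{C} = \{1,\dots,\Delta\}$ be the set of colors. The problem $\Pi$ (a relaxation of $\Delta$-hypergraph coloring, where each hyperedge must have two incident nodes of different colors) is defined as follows. Labels: one label $\ell(\mathcal{C})$ for each (possibly empty) color set $\mathcal{C} \subseteq \mathfrak{C}$. Node constraint: all configurations $\ell(\mathcal{C})^{\Delta-|\mathcal{C}|+1}\,\ell(\emptyset)^{|\mathcal{C}|-1}$ for $\emptyset \neq \mathcal{C} \subseteq \mathfrak{C}$. Hyperedge constraint: all configurations $\ell(\mathcal{C}_1)\dots\ell(\mathcal{C}_r)$ such that for every color $i \in \mathfrak{C}$ there is at least one index $j$ with $i \notin \mathcal{C}_j$. $R(\cdot)$ is the round elimination operator producing the intermediate problem: its hyperedge constraint consists of the maximal configurations $\mathsf{L}_1\dots\mathsf{L}_r$ of nonempty sets of labels of the original problem such that every choice $(\ell_1,\dots,\ell_r)\in \mathsf{L}_1\times\dots\times\mathsf{L}_r$ gives an allowed hyperedge configuration (universal quantifier); its labels are the sets appearing there; its node constraint consists of configurations of these sets for which some choice of one label per set gives an allowed node configuration (existential quantifier).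 $\overline{R}(\cdot)$ is defined symmetrically, applying the universal quantifier (with maximality) to the node constraint and the existential quantifier to the hyperedge constraint. Applying $\overline{R}(R(\cdot))$ yields a problem exactly one round easier (on hypergraphs of sufficiently large girth). -}

module Defs where

open import Data.Nat using (ℕ; zero; suc; _+_; _∸_; _^_; _≤_)
open import Data.Bool using (Bool; true; false; if_then_else_)
open import Data.Fin using (Fin; zero; suc; _↑ˡ_; _↑ʳ_)
open import Data.Fin.Subset using (Subset; _∈_; _∉_; ∣_∣; Nonempty; ⊥)
open import Data.Vec using (Vec; []; _∷_)
import Data.Vec.Properties as VecP
import Data.Bool.Properties as BoolP
open import Data.Product using (Σ; ∃; _×_; _,_)
open import Data.Unit using (⊤)
open import Relation.Binary.PropositionalEquality using (_≡_)
open import Relation.Binary.Definitions using (DecidableEquality)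
open import Relation.Nullary.Decidable using (⌊_⌋)
open import Function using (_∘_; _⇔_)

-- Every problem below has as "label universe" the type  Vec Bool k  for
-- some k; the actual labels are those elements satisfying a predicate
-- IsLabel.  A SET of elements of  Vec Bool k  is represented canonically
-- as a characteristic vector  Subset (2 ^ k)  via the injective binary
-- encoding  enc : Vec Bool k → Fin (2 ^ k).  Thus sets of labels are again
-- elements of a universe of the same shape (with k replaced by 2 ^ k),
-- and equality of sets is just propositional equality.

enc : {k : ℕ} → Vec Bool k → Fin (2 ^ k)
enc {zero}  []          = zero
enc {suc k} (false ∷ x) = enc x ↑ˡ (2 ^ k + 0)
enc {suc k} (true  ∷ x) = (2 ^ k) ↑ʳ (enc x ↑ˡ 0)

_∈ₛ_ : {k : ℕ} → Vec Bool k → Subset (2 ^ k) → Set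
x ∈ₛ S = enc x ∈ S

_⊆ₛ_ : {k : ℕ} → Subset (2 ^ k) → Subset (2 ^ k) → Set
_⊆ₛ_ {k} S T = (x : Vec Bool k) → x ∈ₛ S → x ∈ₛ T

-- A configuration (multiset) of n labels is represented by an ordered
-- tuple  Fin n → label ; constraints are predicates on tuples and are
-- understood as "the multiset of entries of the tuple is allowed".

record Problem (Δ r : ℕ) : Set₁ where
  field
    k       : ℕ
    IsLabel : Vec Bool k → Set
    Node    : (Fin Δ → Vec Bool k) → Set
    Edge    : (Fin r → Vec Bool k) → Set
open Problem public

module _ {Δ r : ℕ} (P : Problem Δ r) where

  LabelSet : Subset (2 ^ k P) → Set
  LabelSet S = ((x : Vec Bool (k P)) → _∈ₛ_ {k P} x S → IsLabel P x)
             × ∃ (λ x → _∈ₛ_ {k P} x S)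

  AllChoices : {n : ℕ} → ((Fin n → Vec Bool (k P)) → Set)
             → (Fin n → Subset (2 ^ k P)) → Set
  AllChoices {n} C T = (c : Fin n → Vec Bool (k P)) → ((j : Fin n) → _∈ₛ_ {k P} (c j) (T j)) → C c

  SomeChoice : {n : ℕ} → ((Fin n → Vec Bool (k P)) → Set)
             → (Fin n → Subset (2 ^ k P)) → Set
  SomeChoice {n} C T = Σ (Fin n → Vec Bool (k P))
                         (λ c → ((j : Fin n) → _∈ₛ_ {k P} (c j) (T j)) × C c)

  MaxUniversal : {n : ℕ} → ((Fin n → Vec Bool (k P)) → Set)
               → (Fin n → Subset (2 ^ k P)) → Set
  MaxUniversal {n} C T =
      ((j : Fin n) → LabelSet (T j))
    × AllChoices C T
    × ((T' : Fin n → Subset (2 ^ k P))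
        → ((j : Fin n) → LabelSet (T' j))
        → AllChoices C T'
        → ((j : Fin n) → _⊆ₛ_ {k P} (T j) (T' j))
        → (j : Fin n) → T' j ≡ T j)

  IsLabelR : Subset (2 ^ k P) → Set
  IsLabelR S = Σ (Fin r → Subset (2 ^ k P))
                 (λ T → MaxUniversal (Edge P) T × ∃ (λ j → T j ≡ S))

  R : Problem Δ r
  R = record
    { k       = 2 ^ k P
    ; IsLabel = IsLabelR
    ; Node    = λ c → ((i : Fin Δ) → IsLabelR (c i)) × SomeChoice (Node P) c
    ; Edge    = MaxUniversal (Edge P)
    }

  IsLabelR̄ : Subset (2 ^ k P) → Set
  IsLabelR̄ S = Σ (Fin Δ → Subset (2 ^ k P))
                  (λ T → MaxUniversal (Node P) T × ∃ (λ i → T i ≡ S))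

  R̄ : Problem Δ r
  R̄ = record
    { k       = 2 ^ k P
    ; IsLabel = IsLabelR̄
    ; Node    = MaxUniversal (Node P)
    ; Edge    = λ c → ((j : Fin r) → IsLabelR̄ (c j)) × SomeChoice (Edge P) c
    }

record _≅ₚ_ {Δ r : ℕ} (P Q : Problem Δ r) : Set where
  field
    f      : Vec Bool (k P) → Vec Bool (k Q)
    f-lab  : (x : Vec Bool (k P)) → IsLabel P x → IsLabel Q (f x)
    f-inj  : (x y : Vec Bool (k P)) → IsLabel P x → IsLabel P y → f x ≡ f y → x ≡ y
    f-surj : (y : Vec Bool (k Q)) → IsLabel Q y → Σ (Vec Bool (k P)) (λ x → IsLabel P x × f x ≡ y)
    P-node-lab : (c : Fin Δ → Vec Bool (k P)) → Node P c → (i : Fin Δ) → IsLabel P (c i)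
    Q-node-lab : (c : Fin Δ → Vec Bool (k Q)) → Node Q c → (i : Fin Δ) → IsLabel Q (c i)
    P-edge-lab : (c : Fin r → Vec Bool (k P)) → Edge P c → (j : Fin r) → IsLabel P (c j)
    Q-edge-lab : (c : Fin r → Vec Bool (k Q)) → Edge Q c → (j : Fin r) → IsLabel Q (c j)
    f-node : (c : Fin Δ → Vec Bool (k P)) → ((i : Fin Δ) → IsLabel P (c i))
           → Node P c ⇔ Node Q (f ∘ c)
    f-edge : (c : Fin r → Vec Bool (k P)) → ((j : Fin r) → IsLabel P (c j))
           → Edge P c ⇔ Edge Q (f ∘ c)

-- The problem Π.  The label ℓ(C) for C ⊆ {1,…,Δ} is represented by the
-- subset C itself (as an element of Vec Bool Δ = Subset Δ); all elements
-- of the universe are labels.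

count : {A : Set} → DecidableEquality A → A → {n : ℕ} → (Fin n → A) → ℕ
count _≟_ a {zero}  c = 0
count _≟_ a {suc n} c = (if ⌊ c zero ≟ a ⌋ then 1 else 0) + count _≟_ a (c ∘ suc)

countΠ : {Δ n : ℕ} → Subset Δ → (Fin n → Subset Δ) → ℕ
countΠ C c = count (VecP.≡-dec BoolP._≟_) C c

Π : (Δ r : ℕ) → Problem Δ r
Π Δ r = record
  { k       = Δ
  ; IsLabel = λ _ → ⊤
    -- ℓ(C)^(Δ-|C|+1) ℓ(∅)^(|C|-1) for nonempty C
  ; Node    = λ c → Σ (Subset Δ) (λ C → Nonempty C
                × countΠ C c ≡ Δ ∸ ∣ C ∣ + 1
                × countΠ ⊥ c ≡ ∣ C ∣ ∸ 1)
  ; Edge    = λ c → (i : Fin Δ) → ∃ (λ j → i ∉ c j)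
  }

module Submission where

-- A label of R(Π) is determined by a colour set X: it is the set of all ℓ(A) with A ∩ X = ∅, because
-- the maximal hyperedge configurations of R(Π) are exactly the fibre configurations of maps h from
-- colours to hyperedge positions, position j receiving {ℓ(A) : A ∩ h⁻¹(j) = ∅}. A label of R̄(R(Π)) is
-- in turn determined by a colour set C: it is the set of those R(Π)-labels whose X misses C, and
-- C ↦ that set is the renaming. A node configuration of Π, sent through this renaming, is a maximal
-- node configuration of R(Π). Conversely, in a maximal node configuration T either some set D of
-- colours occurs in the members of fewer than ∣ D ∣ positions of T, and placing D on the other
-- positions recovers a node configuration of Π; or, by Hall's theorem, every colour d can be matched
-- injectively to a position g d at which some member forbids d, and no node configuration of Π can
-- avoid that.

open import Defs
open import Data.Nat using (ℕ; zero; suc; _+_; _∸_; _^_; _≤_; _<_; z≤n; s≤s; _≤?_)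
import Data.Nat.Properties as ℕₚ
open import Data.Bool using (Bool; true; false; _∧_; _∨_; not; if_then_else_)
import Data.Bool.Properties as Boolₚ
open import Data.Fin using (Fin; zero; suc; _↑ˡ_)
import Data.Fin.Properties as Finₚ
open import Data.Fin.Subset using (Subset; _∈_; _∉_; ∣_∣; Nonempty; ⊥; ⊤; ∁; ⁅_⁆; _∩_; _∪_; _⊆_)
import Data.Fin.Subset.Properties as Subsetₚ
open import Data.Vec using (Vec; []; _∷_; lookup; tabulate; splitAt; _++_)
import Data.Vec.Properties as Vecₚ
open import Data.Product using (Σ; ∃; _×_; _,_; proj₁; proj₂)
open import Data.Sum using (_⊎_; inj₁; inj₂)
import Data.Empty
open import Data.Empty using (⊥-elim)
open import Data.Unit using (tt)
open import Relation.Binary.PropositionalEquality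
open import Relation.Binary.Definitions using (DecidableEquality)
open import Relation.Nullary using (¬_; Dec; yes; no)
open import Relation.Nullary.Decidable using (⌊_⌋; map′; ¬?; _×-dec_; _⊎-dec_; _→-dec_)
open import Algebra.Bundles using (CommutativeMonoid)
import Algebra.Properties.CommutativeSemigroup as CommutativeSemigroupₚ
open import Function using (_∘_; _⇔_; mk⇔)

private
  variable
    n m Δ r : ℕ

true≡false-elim : true ≡ false → {A : Set} → A
true≡false-elim ()

∧≡true-left : ∀ {a b} → a ∧ b ≡ true → a ≡ true
∧≡true-left {true} _ = refl

∧≡true-right : ∀ {a b} → a ∧ b ≡ true → b ≡ true
∧≡true-right {true} e = e

∧≡true : ∀ {a b} → a ≡ true → b ≡ true → a ∧ b ≡ true
∧≡true refl refl = refl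

not≡false : ∀ {b} → not b ≡ false → b ≡ true
not≡false {true} _ = refl

not≡true : ∀ {b} → not b ≡ true → b ≡ false
not≡true {false} _ = refl

_≟ᵛ_ : DecidableEquality (Vec Bool n)
_≟ᵛ_ = Vecₚ.≡-dec Boolₚ._≟_

-- the equality test counted by countΠ, so that countΠ≡card holds by refl
_==_ : Vec Bool n → Vec Bool n → Bool
x == y = ⌊ x ≟ᵛ y ⌋

==-refl : (x : Vec Bool n) → x == x ≡ true
==-refl x with x ≟ᵛ x
... | yes _ = refl
... | no x≢x = ⊥-elim (x≢x refl)

==⇒≡ : (x y : Vec Bool n) → x == y ≡ true → x ≡ y
==⇒≡ x y e with x ≟ᵛ y
... | yes x≡y = x≡y

≢⇒==false : (x y : Vec Bool n) → ¬ x ≡ y → x == y ≡ false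
≢⇒==false x y x≢y with x ≟ᵛ y
... | yes x≡y = ⊥-elim (x≢y x≡y)
... | no _ = refl

_=ᶠ_ : Fin n → Fin n → Bool
zero =ᶠ zero = true
zero =ᶠ suc _ = false
suc _ =ᶠ zero = false
suc i =ᶠ suc j = i =ᶠ j

=ᶠ-refl : (i : Fin n) → i =ᶠ i ≡ true
=ᶠ-refl zero = refl
=ᶠ-refl (suc i) = =ᶠ-refl i

=ᶠ⇒≡ : (i j : Fin n) → i =ᶠ j ≡ true → i ≡ j
=ᶠ⇒≡ zero zero _ = refl
=ᶠ⇒≡ (suc i) (suc j) e = cong suc (=ᶠ⇒≡ i j e)

anyᶠ : (Fin n → Bool) → Bool
anyᶠ {zero} p = false
anyᶠ {suc n} p = p zero ∨ anyᶠ (p ∘ suc)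

allᶠ : (Fin n → Bool) → Bool
allᶠ {zero} p = true
allᶠ {suc n} p = p zero ∧ allᶠ (p ∘ suc)

anyᶠ-witness : (p : Fin n → Bool) → anyᶠ p ≡ true → ∃ λ j → p j ≡ true
anyᶠ-witness {suc n} p e with p zero in ep
... | true = zero , ep
... | false = let (j , q) = anyᶠ-witness (p ∘ suc) e in suc j , q

anyᶠ-intro : (p : Fin n → Bool) (j : Fin n) → p j ≡ true → anyᶠ p ≡ true
anyᶠ-intro {suc n} p zero e rewrite e = refl
anyᶠ-intro {suc n} p (suc j) e with p zero
... | true = refl
... | false = anyᶠ-intro (p ∘ suc) j e

anyᶠ≡false : (p : Fin n → Bool) → anyᶠ p ≡ false → ∀ j → p j ≡ false
anyᶠ≡false p e j with p j in ej
... | false = refl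
... | true = true≡false-elim (trans (sym (anyᶠ-intro p j ej)) e)

anyᶠ-cong : {p q : Fin n → Bool} → (∀ j → p j ≡ q j) → anyᶠ p ≡ anyᶠ q
anyᶠ-cong {zero} h = refl
anyᶠ-cong {suc n} h = cong₂ _∨_ (h zero) (anyᶠ-cong (h ∘ suc))

allᶠ-elim : (p : Fin n → Bool) → allᶠ p ≡ true → ∀ j → p j ≡ true
allᶠ-elim {suc n} p e j with p zero in ep
allᶠ-elim {suc n} p e zero | true = ep
allᶠ-elim {suc n} p e (suc j) | true = allᶠ-elim (p ∘ suc) e j

allᶠ-intro : (p : Fin n → Bool) → (∀ j → p j ≡ true) → allᶠ p ≡ true
allᶠ-intro {zero} p h = refl
allᶠ-intro {suc n} p h rewrite h zero = allᶠ-intro (p ∘ suc) (h ∘ suc)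

allᶠ-counterexample : (p : Fin n → Bool) → allᶠ p ≡ false → ∃ λ j → p j ≡ false
allᶠ-counterexample {suc n} p e with p zero in ep
... | false = zero , ep
... | true = let (j , q) = allᶠ-counterexample (p ∘ suc) e in suc j , q

-- the first position satisfying p (junk value: the last one if there is none)
find : (Fin (suc n) → Bool) → Fin (suc n)
find {zero} p = zero
find {suc n} p = if p zero then zero else suc (find (p ∘ suc))

find-satisfies : (p : Fin (suc n) → Bool) → anyᶠ p ≡ true → p (find p) ≡ true
find-satisfies {zero} p e with p zero
... | true = refl
find-satisfies {suc n} p e with p zero in ep
... | true = ep
... | false = find-satisfies (p ∘ suc) e

anyᵛ : (Vec Bool n → Bool) → Bool
anyᵛ {zero} b = b []
anyᵛ {suc n} b = anyᵛ (λ v → b (false ∷ v)) ∨ anyᵛ (λ v → b (true ∷ v))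

anyᵛ-witness : (b : Vec Bool n → Bool) → anyᵛ b ≡ true → ∃ λ v → b v ≡ true
anyᵛ-witness {zero} b e = [] , e
anyᵛ-witness {suc n} b e with anyᵛ (λ v → b (false ∷ v)) in e₀
... | true = let (v , q) = anyᵛ-witness _ e₀ in false ∷ v , q
... | false = let (v , q) = anyᵛ-witness _ e in true ∷ v , q

anyᵛ-intro : (b : Vec Bool n → Bool) (v : Vec Bool n) → b v ≡ true → anyᵛ b ≡ true
anyᵛ-intro {zero} b [] e = e
anyᵛ-intro {suc n} b (false ∷ v) e rewrite anyᵛ-intro (λ v → b (false ∷ v)) v e = refl
anyᵛ-intro {suc n} b (true ∷ v) e rewrite anyᵛ-intro (λ v → b (true ∷ v)) v e =
  Boolₚ.∨-zeroʳ _

card : (Fin n → Bool) → ℕ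
card {zero} p = 0
card {suc n} p = (if p zero then 1 else 0) + card (p ∘ suc)

card-cong : {p q : Fin n → Bool} → (∀ j → p j ≡ q j) → card p ≡ card q
card-cong {zero} e = refl
card-cong {suc n} e = cong₂ (λ a b → (if a then 1 else 0) + b) (e zero) (card-cong (e ∘ suc))

card-mono : {p q : Fin n → Bool} → (∀ j → p j ≡ true → q j ≡ true) → card p ≤ card q
card-mono {zero} h = z≤n
card-mono {suc n} {p} {q} h with p zero in ep | q zero in eq
... | true | true = s≤s (card-mono (h ∘ suc))
... | true | false = true≡false-elim (trans (sym (h zero ep)) eq)
... | false | true = ℕₚ.m≤n⇒m≤1+n (card-mono (h ∘ suc))
... | false | false = card-mono (h ∘ suc)

card≤n : (p : Fin n → Bool) → card p ≤ n
card≤n {zero} p = z≤n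
card≤n {suc n} p with p zero
... | true = s≤s (card≤n (p ∘ suc))
... | false = ℕₚ.m≤n⇒m≤1+n (card≤n (p ∘ suc))

card+card-not≡n : (p : Fin n → Bool) → card p + card (not ∘ p) ≡ n
card+card-not≡n {zero} p = refl
card+card-not≡n {suc n} p with p zero
... | true = cong suc (card+card-not≡n (p ∘ suc))
... | false = trans (ℕₚ.+-suc (card (p ∘ suc)) _) (cong suc (card+card-not≡n (p ∘ suc)))

card≡0 : (p : Fin n → Bool) → card p ≡ 0 → ∀ j → p j ≡ false
card≡0 {suc n} p e j with p zero in ep
card≡0 {suc n} p e zero | false = ep
card≡0 {suc n} p e (suc j) | false = card≡0 (p ∘ suc) e j

card≥1 : (p : Fin n → Bool) → 1 ≤ card p → ∃ λ j → p j ≡ true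
card≥1 {suc n} p h with p zero in ep
... | true = zero , ep
... | false = let (j , e) = card≥1 (p ∘ suc) h in suc j , e

card-const-true : card (λ (_ : Fin n) → true) ≡ n
card-const-true {zero} = refl
card-const-true {suc n} = cong suc card-const-true

card-const-false : card (λ (_ : Fin n) → false) ≡ 0
card-const-false {zero} = refl
card-const-false {suc n} = card-const-false {n}

card-∨ : (p q : Fin n → Bool) → card (λ j → p j ∨ q j) ≡ card (λ j → p j ∧ not (q j)) + card q
card-∨ {zero} p q = refl
card-∨ {suc n} p q with p zero | q zero
... | true | true = trans (cong suc (card-∨ (p ∘ suc) (q ∘ suc))) (sym (ℕₚ.+-suc _ _))
... | true | false = cong suc (card-∨ (p ∘ suc) (q ∘ suc))
... | false | true = trans (cong suc (card-∨ (p ∘ suc) (q ∘ suc))) (sym (ℕₚ.+-suc _ _))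
... | false | false = card-∨ (p ∘ suc) (q ∘ suc)

card-split : (p q : Fin n → Bool) → card (λ j → p j ∧ not (q j)) + card (λ j → p j ∧ q j) ≡ card p
card-split {zero} p q = refl
card-split {suc n} p q with p zero | q zero
... | true | true = trans (ℕₚ.+-suc _ _) (cong suc (card-split (p ∘ suc) (q ∘ suc)))
... | true | false = cong suc (card-split (p ∘ suc) (q ∘ suc))
... | false | true = card-split (p ∘ suc) (q ∘ suc)
... | false | false = card-split (p ∘ suc) (q ∘ suc)

card-at : (p : Fin n → Bool) (i : Fin n) → card (λ j → p j ∧ (j =ᶠ i)) ≡ (if p i then 1 else 0)
card-at {suc n} p zero with p zero
... | true = cong suc (trans (card-cong (λ j → Boolₚ.∧-zeroʳ (p (suc j)))) (card-const-false {n}))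
... | false = trans (card-cong (λ j → Boolₚ.∧-zeroʳ (p (suc j)))) (card-const-false {n})
card-at {suc n} p (suc i) with p zero
... | true = card-at (p ∘ suc) i
... | false = card-at (p ∘ suc) i

card-remove : (p : Fin n → Bool) (i : Fin n) →
              card p ≡ card (λ j → p j ∧ not (j =ᶠ i)) + (if p i then 1 else 0)
card-remove p i = begin
  card p                                                            ≡⟨ card-split p (_=ᶠ i) ⟨
  card (λ j → p j ∧ not (j =ᶠ i)) + card (λ j → p j ∧ (j =ᶠ i))     ≡⟨ cong (card (λ j → p j ∧ not (j =ᶠ i)) +_) (card-at p i) ⟩
  card (λ j → p j ∧ not (j =ᶠ i)) + (if p i then 1 else 0)          ∎
  where open ≡-Reasoning

card-pos : (p : Fin n → Bool) (i : Fin n) → p i ≡ true → 1 ≤ card p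
card-pos p i e rewrite card-remove p i | e = ℕₚ.m≤n+m 1 _

∣∣≡card : (X : Subset n) → ∣ X ∣ ≡ card (lookup X)
∣∣≡card [] = refl
∣∣≡card (true ∷ X) = cong suc (∣∣≡card X)
∣∣≡card (false ∷ X) = ∣∣≡card X

select : (Fin n → Bool) → ℕ → Fin n → Bool
select p zero j = false
select {suc n} p (suc k) zero = p zero
select {suc n} p (suc k) (suc j) = select (p ∘ suc) (if p zero then k else suc k) j

select⊆ : (p : Fin n → Bool) (k : ℕ) (j : Fin n) → select p k j ≡ true → p j ≡ true
select⊆ {suc n} p (suc k) zero e = e
select⊆ {suc n} p (suc k) (suc j) e = select⊆ (p ∘ suc) (if p zero then k else suc k) j e

card-select : (p : Fin n → Bool) (k : ℕ) → k ≤ card p → card (select p k) ≡ k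
card-select {n} p zero _ = trans (card-cong {n} (λ _ → refl)) (card-const-false {n})
card-select {suc n} p (suc k) h with p zero
... | true = cong suc (card-select (p ∘ suc) k (ℕₚ.≤-pred h))
... | false = card-select (p ∘ suc) (suc k) h

lookup-ext : (x y : Vec Bool n) → (∀ i → lookup x i ≡ lookup y i) → x ≡ y
lookup-ext x y h = begin
  x                  ≡⟨ Vecₚ.tabulate∘lookup x ⟨
  tabulate (lookup x) ≡⟨ Vecₚ.tabulate-cong h ⟩
  tabulate (lookup y) ≡⟨ Vecₚ.tabulate∘lookup y ⟩
  y                  ∎
  where open ≡-Reasoning

∈⇒lookup : {i : Fin n} {X : Subset n} → i ∈ X → lookup X i ≡ true
∈⇒lookup = Vecₚ.[]=⇒lookup

lookup⇒∈ : {i : Fin n} {X : Subset n} → lookup X i ≡ true → i ∈ X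
lookup⇒∈ {i = i} {X} = Vecₚ.lookup⇒[]= i X

lookup-⊥ : (i : Fin n) → lookup ⊥ i ≡ false
lookup-⊥ i = Vecₚ.lookup-replicate i false

lookup-⊤ : (i : Fin n) → lookup ⊤ i ≡ true
lookup-⊤ i = Vecₚ.lookup-replicate i true

lookup-∁ : (X : Subset n) (i : Fin n) → lookup (∁ X) i ≡ not (lookup X i)
lookup-∁ X i = Vecₚ.lookup-map i not X

lookup-∩ : (X Y : Subset n) (i : Fin n) → lookup (X ∩ Y) i ≡ lookup X i ∧ lookup Y i
lookup-∩ X Y i = Vecₚ.lookup-zipWith _∧_ i X Y

lookup-∪ : (X Y : Subset n) (i : Fin n) → lookup (X ∪ Y) i ≡ lookup X i ∨ lookup Y i
lookup-∪ X Y i = Vecₚ.lookup-zipWith _∨_ i X Y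

lookup-⁅⁆ : (c i : Fin n) → lookup ⁅ c ⁆ i ≡ i =ᶠ c
lookup-⁅⁆ zero zero = refl
lookup-⁅⁆ zero (suc i) = lookup-⊥ i
lookup-⁅⁆ (suc c) zero = refl
lookup-⁅⁆ (suc c) (suc i) = lookup-⁅⁆ c i

lookup-∩∁ : (X Y : Subset n) (i : Fin n) → lookup (X ∩ ∁ Y) i ≡ lookup X i ∧ not (lookup Y i)
lookup-∩∁ X Y i = trans (lookup-∩ X (∁ Y) i) (cong (lookup X i ∧_) (lookup-∁ Y i))

_∈ᵇ_ : {k : ℕ} → Vec Bool k → Subset (2 ^ k) → Bool
x ∈ᵇ S = lookup S (enc x)

-- follows enc, with 2 ^ suc k unfolding to 2 ^ k + (2 ^ k + 0)
setOf : {k : ℕ} → (Vec Bool k → Bool) → Subset (2 ^ k)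
setOf {zero} p = p [] ∷ []
setOf {suc k} p = setOf {k} (λ v → p (false ∷ v)) ++ (setOf {k} (λ v → p (true ∷ v)) ++ [])

∈ᵇ-setOf : {k : ℕ} (p : Vec Bool k → Bool) (x : Vec Bool k) → x ∈ᵇ setOf p ≡ p x
∈ᵇ-setOf {zero} p [] = refl
∈ᵇ-setOf {suc k} p (false ∷ x) =
  trans (Vecₚ.lookup-++ˡ (setOf {k} (λ v → p (false ∷ v))) _ (enc x)) (∈ᵇ-setOf {k} _ x)
∈ᵇ-setOf {suc k} p (true ∷ x) =
  trans (Vecₚ.lookup-++ʳ (setOf {k} (λ v → p (false ∷ v))) _ (enc x ↑ˡ 0))
    (trans (Vecₚ.lookup-++ˡ (setOf {k} (λ v → p (true ∷ v))) [] (enc x)) (∈ᵇ-setOf {k} _ x))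

setOf-cong : {k : ℕ} {p q : Vec Bool k → Bool} → (∀ x → p x ≡ q x) → setOf p ≡ setOf q
setOf-cong {zero} h = cong (_∷ []) (h [])
setOf-cong {suc k} h = cong₂ _++_ (setOf-cong {k} (λ v → h (false ∷ v)))
                                  (cong (_++ []) (setOf-cong {k} (λ v → h (true ∷ v))))

setOf-∈ᵇ : {k : ℕ} (S : Subset (2 ^ k)) → S ≡ setOf {k} (_∈ᵇ S)
setOf-∈ᵇ {zero} (b ∷ []) = refl
setOf-∈ᵇ {suc k} S with splitAt (2 ^ k) S
... | ys , zs , refl with splitAt (2 ^ k) zs
... | ws , [] , refl =
  cong₂ _++_
    (trans (setOf-∈ᵇ {k} ys) (setOf-cong {k} (λ x → sym (Vecₚ.lookup-++ˡ ys (ws ++ []) (enc x)))))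
    (cong (_++ []) (trans (setOf-∈ᵇ {k} ws) (setOf-cong {k} (λ x → sym
      (trans (Vecₚ.lookup-++ʳ ys (ws ++ []) (enc x ↑ˡ 0)) (Vecₚ.lookup-++ˡ ws [] (enc x)))))))

∈ᵇ-ext : {k : ℕ} (S T : Subset (2 ^ k)) → ((x : Vec Bool k) → x ∈ᵇ S ≡ x ∈ᵇ T) → S ≡ T
∈ᵇ-ext {k} S T h = trans (setOf-∈ᵇ {k} S) (trans (setOf-cong {k} h) (sym (setOf-∈ᵇ {k} T)))

-- Hall's marriage theorem

∨-interchange : (a b c d : Bool) → (a ∨ b) ∨ (c ∨ d) ≡ (a ∨ c) ∨ (b ∨ d)
∨-interchange = CommutativeSemigroupₚ.interchange
  (CommutativeMonoid.commutativeSemigroup Boolₚ.∨-commutativeMonoid)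

anyᶠ-∨ : (p q : Fin n → Bool) → anyᶠ (λ d → p d ∨ q d) ≡ anyᶠ p ∨ anyᶠ q
anyᶠ-∨ {zero} p q = refl
anyᶠ-∨ {suc n} p q =
  trans (cong ((p zero ∨ q zero) ∨_) (anyᶠ-∨ (p ∘ suc) (q ∘ suc))) (∨-interchange (p zero) (q zero) _ _)

anyᶠ-∧ʳ : (p : Fin n → Bool) (b : Bool) → anyᶠ (λ d → p d ∧ b) ≡ anyᶠ p ∧ b
anyᶠ-∧ʳ {zero} p b = refl
anyᶠ-∧ʳ {suc n} p b =
  trans (cong ((p zero ∧ b) ∨_) (anyᶠ-∧ʳ (p ∘ suc) b)) (sym (Boolₚ.∧-distribʳ-∨ b (p zero) _))

∃ᵛ? : {P : Vec Bool n → Set} → ((v : Vec Bool n) → Dec (P v)) → Dec (∃ P)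
∃ᵛ? {zero} P? = map′ ([] ,_) (λ { ([] , p) → p }) (P? [])
∃ᵛ? {suc n} P? = map′
  (λ { (inj₁ (v , p)) → false ∷ v , p ; (inj₂ (v , p)) → true ∷ v , p })
  (λ { (false ∷ v , p) → inj₁ (v , p) ; (true ∷ v , p) → inj₂ (v , p) })
  (∃ᵛ? (P? ∘ (false ∷_)) ⊎-dec ∃ᵛ? (P? ∘ (true ∷_)))

nonempty? : (X : Subset n) → Dec (∃ λ d → lookup X d ≡ true)
nonempty? X = Finₚ.any? (λ d → lookup X d Boolₚ.≟ true)

card-none : (p : Fin n → Bool) → ¬ (∃ λ d → p d ≡ true) → card p ≡ 0
card-none {n} p none = trans (card-cong (λ d → Boolₚ.¬-not (λ pd → none (d , pd)))) (card-const-false {n})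

_⊑_ : Subset n → Subset n → Set
D ⊑ I = ∀ d → lookup D d ≡ true → lookup I d ≡ true

_⊑?_ : (D I : Subset n) → Dec (D ⊑ I)
D ⊑? I = Finₚ.all? (λ d → (lookup D d Boolₚ.≟ true) →-dec (lookup I d Boolₚ.≟ true))

card-∪ : (E D : Subset n) → (∀ d → lookup E d ≡ true → lookup D d ≡ false) →
         card (lookup (E ∪ D)) ≡ card (lookup E) + card (lookup D)
card-∪ E D disjoint = begin
  card (lookup (E ∪ D))                                  ≡⟨ card-cong (lookup-∪ E D) ⟩
  card (λ d → lookup E d ∨ lookup D d)                   ≡⟨ card-∨ (lookup E) (lookup D) ⟩
  card (λ d → lookup E d ∧ not (lookup D d)) + card (lookup D) ≡⟨ cong (_+ card (lookup D)) (card-cong only-E) ⟩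
  card (lookup E) + card (lookup D)                      ∎
  where
  open ≡-Reasoning
  only-E : ∀ d → lookup E d ∧ not (lookup D d) ≡ lookup E d
  only-E d with lookup E d in e
  ... | true = cong not (disjoint d e)
  ... | false = refl

card-< : (D I : Subset n) (d : Fin n) → D ⊑ I → lookup I d ≡ true → lookup D d ≡ false →
         card (lookup D) < card (lookup I)
card-< D I d D⊑I d∈I d∉D = begin-strict
  card (lookup D)                                         <⟨ s≤s (card-mono D⊆rest) ⟩
  suc (card rest)                                         ≡⟨ ℕₚ.+-comm 1 (card rest) ⟩
  card rest + (if true then 1 else 0)                     ≡⟨ cong (λ b → card rest + (if b then 1 else 0)) d∈I ⟨
  card rest + (if lookup I d then 1 else 0)               ≡⟨ card-remove (lookup I) d ⟨
  card (lookup I)                                         ∎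
  where
  open ℕₚ.≤-Reasoning
  rest : Fin _ → Bool
  rest j = lookup I j ∧ not (j =ᶠ d)
  D⊆rest : ∀ j → lookup D j ≡ true → rest j ≡ true
  D⊆rest j j∈D with j =ᶠ d in e
  ... | false = ∧≡true (D⊑I j j∈D) refl
  ... | true = true≡false-elim (trans (sym j∈D) (subst (λ x → lookup D x ≡ false) (sym (=ᶠ⇒≡ j d e)) d∉D))

⊑-proper : (D I : Subset n) → D ⊑ I → D ≢ I → ∃ λ d → lookup I d ≡ true × lookup D d ≡ false
⊑-proper D I D⊑I D≢I with anyᶠ (λ d → lookup I d ∧ not (lookup D d)) in e
... | true = let (d , q) = anyᶠ-witness _ e in d , ∧≡true-left q , not≡true (∧≡true-right q)
... | false = ⊥-elim (D≢I (lookup-ext D I same))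
  where
  same : ∀ d → lookup D d ≡ lookup I d
  same d with lookup D d in e₁ | lookup I d in e₂
  ... | true | true = refl
  ... | false | false = refl
  ... | true | false = true≡false-elim (trans (sym (D⊑I d e₁)) e₂)
  ... | false | true = true≡false-elim (trans (sym (cong₂ _∧_ e₂ (cong not e₁))) (anyᶠ≡false _ e d))

∩∁⊑ : (I D : Subset n) → (I ∩ ∁ D) ⊑ I
∩∁⊑ I D d e = ∧≡true-left (trans (sym (lookup-∩∁ I D d)) e)

module _ {n m : ℕ} where

  neighbours : (Fin n → Fin m → Bool) → Subset n → Fin m → Bool
  neighbours N D j = anyᶠ (λ d → lookup D d ∧ N d j)

  HallCondition : (Fin n → Fin m → Bool) → Subset n → Set
  HallCondition N I = ∀ D → D ⊑ I → card (lookup D) ≤ card (neighbours N D)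

  record Matching (N : Fin n → Fin m → Bool) (I : Subset n) : Set where
    field
      match : Fin n → Fin m
      match-edge : ∀ d → lookup I d ≡ true → N d (match d) ≡ true
      match-injective : ∀ d e → lookup I d ≡ true → lookup I e ≡ true → match d ≡ match e → d ≡ e

  open Matching public

  avoiding : (Fin n → Fin m → Bool) → (Fin m → Bool) → Fin n → Fin m → Bool
  avoiding N B d j = N d j ∧ not (B j)

  neighbours-∪ : (N : Fin n → Fin m → Bool) (E D : Subset n) (j : Fin m) →
                 neighbours N (E ∪ D) j ≡ neighbours N E j ∨ neighbours N D j
  neighbours-∪ N E D j = trans
    (anyᶠ-cong (λ d → trans (cong (_∧ N d j) (lookup-∪ E D d)) (Boolₚ.∧-distribʳ-∨ (N d j) (lookup E d) (lookup D d))))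
    (anyᶠ-∨ (λ d → lookup E d ∧ N d j) (λ d → lookup D d ∧ N d j))

  neighbours-avoiding : (N : Fin n → Fin m → Bool) (B : Fin m → Bool) (E : Subset n) (j : Fin m) →
                        neighbours (avoiding N B) E j ≡ neighbours N E j ∧ not (B j)
  neighbours-avoiding N B E j = trans
    (anyᶠ-cong (λ d → sym (Boolₚ.∧-assoc (lookup E d) (N d j) (not (B j)))))
    (anyᶠ-∧ʳ (λ d → lookup E d ∧ N d j) (not (B j)))

  glue : (N : Fin n → Fin m → Bool) (I D : Subset n) (B : Fin m → Bool) (M₁ : Matching N D) →
         (∀ d → lookup D d ≡ true → B (match M₁ d) ≡ true) →
         Matching (avoiding N B) (I ∩ ∁ D) → Matching N I
  glue N I D B M₁ M₁-in-B M₂ = record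
    { match = λ d → if lookup D d then match M₁ d else match M₂ d
    ; match-edge = edge
    ; match-injective = injective
    }
    where
    rest : ∀ d → lookup I d ≡ true → lookup D d ≡ false → lookup (I ∩ ∁ D) d ≡ true
    rest d d∈I d∉D = trans (lookup-∩∁ I D d) (∧≡true d∈I (cong not d∉D))

    separated : ∀ d e → lookup D d ≡ true → lookup (I ∩ ∁ D) e ≡ true → match M₁ d ≢ match M₂ e
    separated d e d∈D e∈rest eq = true≡false-elim (trans (sym (M₁-in-B d d∈D))
      (trans (cong B eq) (not≡true (∧≡true-right (match-edge M₂ e e∈rest)))))

    edge : ∀ d → lookup I d ≡ true → N d (if lookup D d then match M₁ d else match M₂ d) ≡ true
    edge d d∈I with lookup D d in e
    ... | true = match-edge M₁ d e
    ... | false = ∧≡true-left (match-edge M₂ d (rest d d∈I e))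

    injective : ∀ d e → lookup I d ≡ true → lookup I e ≡ true →
                (if lookup D d then match M₁ d else match M₂ d) ≡ (if lookup D e then match M₁ e else match M₂ e) →
                d ≡ e
    injective d e d∈I e∈I eq with lookup D d in ed | lookup D e in ee
    ... | true | true = match-injective M₁ d e ed ee eq
    ... | false | false = match-injective M₂ d e (rest d d∈I ed) (rest e e∈I ee) eq
    ... | true | false = ⊥-elim (separated d e ed (rest e e∈I ee) eq)
    ... | false | true = ⊥-elim (separated e d ee (rest d d∈I ed) (sym eq))

  singleton-matching : (N : Fin n → Fin m → Bool) (i : Fin n) (t : Fin m) → N i t ≡ true → Matching N ⁅ i ⁆
  singleton-matching N i t Nit = record
    { match = λ _ → t
    ; match-edge = λ d d∈ → subst (λ x → N x t ≡ true) (sym (is-i d d∈)) Nit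
    ; match-injective = λ d e d∈ e∈ _ → trans (is-i d d∈) (sym (is-i e e∈))
    }
    where
    is-i : ∀ d → lookup ⁅ i ⁆ d ≡ true → d ≡ i
    is-i d d∈ = =ᶠ⇒≡ d i (trans (sym (lookup-⁅⁆ i d)) d∈)

  record Critical (N : Fin n → Fin m → Bool) (I D : Subset n) : Set where
    field
      critical-⊑ : D ⊑ I
      critical-nonempty : ∃ λ d → lookup D d ≡ true
      critical-proper : D ≢ I
      critical-tight : card (neighbours N D) ≤ card (lookup D)

  critical? : (N : Fin n → Fin m → Bool) (I D : Subset n) → Dec (Critical N I D)
  critical? N I D = map′
    (λ (a , b , c , d) → record { critical-⊑ = a ; critical-nonempty = b ; critical-proper = c ; critical-tight = d })
    (λ C → let open Critical C in critical-⊑ , critical-nonempty , critical-proper , critical-tight)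
    ((D ⊑? I) ×-dec nonempty? D ×-dec ¬? (D ≟ᵛ I) ×-dec (card (neighbours N D) ≤? card (lookup D)))

  hall-restrict : {N : Fin n → Fin m → Bool} {I D : Subset n} → HallCondition N I → D ⊑ I → HallCondition N D
  hall-restrict hc D⊑I E E⊑D = hc E (λ d → D⊑I d ∘ E⊑D d)

  -- Apply Hall's condition to E ∪ D: D accounts for at most ∣ D ∣ of its neighbours.
  hall-beyond-critical : (N : Fin n → Fin m → Bool) (I D : Subset n) → HallCondition N I → D ⊑ I →
                         card (neighbours N D) ≤ card (lookup D) →
                         HallCondition (avoiding N (neighbours N D)) (I ∩ ∁ D)
  hall-beyond-critical N I D hc D⊑I tight E E⊑rest = ℕₚ.+-cancelʳ-≤ (card (lookup D)) _ _ (begin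
    card (lookup E) + card (lookup D)                      ≡⟨ card-∪ E D E∩D≡∅ ⟨
    card (lookup (E ∪ D))                                  ≤⟨ hc (E ∪ D) E∪D⊑I ⟩
    card (neighbours N (E ∪ D))                            ≡⟨ card-cong (neighbours-∪ N E D) ⟩
    card (λ j → neighbours N E j ∨ neighbours N D j)       ≡⟨ card-∨ (neighbours N E) (neighbours N D) ⟩
    card (λ j → neighbours N E j ∧ not (neighbours N D j)) + card (neighbours N D)
      ≡⟨ cong (_+ card (neighbours N D)) (card-cong (λ j → sym (neighbours-avoiding N (neighbours N D) E j))) ⟩
    card (neighbours N′ E) + card (neighbours N D)         ≤⟨ ℕₚ.+-monoʳ-≤ (card (neighbours N′ E)) tight ⟩
    card (neighbours N′ E) + card (lookup D)               ∎)
    where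
    open ℕₚ.≤-Reasoning
    N′ : Fin n → Fin m → Bool
    N′ = avoiding N (neighbours N D)
    E-rest : ∀ d → lookup E d ≡ true → lookup I d ∧ not (lookup D d) ≡ true
    E-rest d d∈E = trans (sym (lookup-∩∁ I D d)) (E⊑rest d d∈E)
    E∩D≡∅ : ∀ d → lookup E d ≡ true → lookup D d ≡ false
    E∩D≡∅ d d∈E = not≡true (∧≡true-right (E-rest d d∈E))
    E∪D⊑I : (E ∪ D) ⊑ I
    E∪D⊑I d d∈ with lookup E d in e
    ... | true = ∧≡true-left (E-rest d e)
    ... | false = D⊑I d (trans (cong (_∨ lookup D d) (sym e)) (trans (sym (lookup-∪ E D d)) d∈))

  -- Without critical sets every nonempty E ⊂ I has a surplus neighbour, which pays for losing t.
  hall-beyond-loose : (N : Fin n → Fin m → Bool) (I : Subset n) (i : Fin n) (t : Fin m) →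
                      lookup I i ≡ true → ¬ (∃ (Critical N I)) →
                      HallCondition (avoiding N (_=ᶠ t)) (I ∩ ∁ ⁅ i ⁆)
  hall-beyond-loose N I i t i∈I no-critical E E⊑rest with nonempty? E
  ... | no empty = subst (_≤ card (neighbours (avoiding N (_=ᶠ t)) E)) (sym (card-none (lookup E) empty)) z≤n
  ... | yes nonempty = ℕₚ.≤-pred (begin
    suc (card (lookup E))                                  ≤⟨ ℕₚ.≰⇒> (λ tight → no-critical (E , critical tight)) ⟩
    card (neighbours N E)                                  ≡⟨ card-remove (neighbours N E) t ⟩
    card (λ j → neighbours N E j ∧ not (j =ᶠ t)) + (if neighbours N E t then 1 else 0)
      ≤⟨ ℕₚ.+-mono-≤ (ℕₚ.≤-reflexive (card-cong (λ j → sym (neighbours-avoiding N (_=ᶠ t) E j)))) (bit≤1 _) ⟩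
    card (neighbours (avoiding N (_=ᶠ t)) E) + 1           ≡⟨ ℕₚ.+-comm _ 1 ⟩
    suc (card (neighbours (avoiding N (_=ᶠ t)) E))          ∎)
    where
    open ℕₚ.≤-Reasoning
    bit≤1 : ∀ b → (if b then 1 else 0) ≤ 1
    bit≤1 true = ℕₚ.≤-refl
    bit≤1 false = z≤n
    E-rest : ∀ d → lookup E d ≡ true → lookup I d ∧ not (lookup ⁅ i ⁆ d) ≡ true
    E-rest d d∈E = trans (sym (lookup-∩∁ I ⁅ i ⁆ d)) (E⊑rest d d∈E)
    i∉E : lookup E i ≢ true
    i∉E i∈E = true≡false-elim (trans (sym (=ᶠ-refl i))
      (trans (sym (lookup-⁅⁆ i i)) (not≡true (∧≡true-right (E-rest i i∈E)))))
    critical : card (neighbours N E) ≤ card (lookup E) → Critical N I E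
    critical tight = record
      { critical-⊑ = λ d d∈E → ∧≡true-left (E-rest d d∈E)
      ; critical-nonempty = nonempty
      ; critical-proper = λ E≡I → i∉E (trans (cong (λ X → lookup X i) E≡I) i∈I)
      ; critical-tight = tight
      }

  neighbour : (N : Fin n → Fin m → Bool) (I : Subset n) (i : Fin n) → HallCondition N I → lookup I i ≡ true →
              ∃ λ t → N i t ≡ true
  neighbour N I i hc i∈I =
    let (t , t∈) = card≥1 (neighbours N ⁅ i ⁆) (subst (_≤ card (neighbours N ⁅ i ⁆)) one (hc ⁅ i ⁆ ⁅i⁆⊑I))
        (d , d∈) = anyᶠ-witness _ t∈
    in t , subst (λ x → N x t ≡ true) (is-i d (∧≡true-left d∈)) (∧≡true-right d∈)
    where
    is-i : ∀ d → lookup ⁅ i ⁆ d ≡ true → d ≡ i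
    is-i d d∈ = =ᶠ⇒≡ d i (trans (sym (lookup-⁅⁆ i d)) d∈)
    ⁅i⁆⊑I : ⁅ i ⁆ ⊑ I
    ⁅i⁆⊑I d d∈ = subst (λ x → lookup I x ≡ true) (sym (is-i d d∈)) i∈I
    one : card (lookup ⁅ i ⁆) ≡ 1
    one = trans (sym (∣∣≡card ⁅ i ⁆)) (Subsetₚ.∣⁅x⁆∣≡1 i)

  hall : Fin m → (k : ℕ) (N : Fin n → Fin m → Bool) (I : Subset n) →
         card (lookup I) ≤ k → HallCondition N I → Matching N I
  hall t₀ k N I size hc with nonempty? I
  ... | no empty = record
    { match = λ _ → t₀
    ; match-edge = λ d d∈I → ⊥-elim (empty (d , d∈I))
    ; match-injective = λ d _ d∈I _ _ → ⊥-elim (empty (d , d∈I))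
    }
  hall t₀ zero N I size hc | yes (i , i∈I) = ⊥-elim (ℕₚ.<⇒≱ (card-pos (lookup I) i i∈I) size)
  hall t₀ (suc k) N I size hc | yes (i , i∈I) with ∃ᵛ? (critical? N I)
  ... | yes (D , crit) = glue N I D (neighbours N D) M₁ M₁-in-N[D] M₂
    where
    open Critical crit
    shrinks : (D′ : Subset n) (d : Fin n) → D′ ⊑ I → lookup I d ≡ true → lookup D′ d ≡ false → card (lookup D′) ≤ k
    shrinks D′ d D′⊑I d∈I d∉D′ = ℕₚ.≤-pred (ℕₚ.≤-trans (card-< D′ I d D′⊑I d∈I d∉D′) size)
    M₁ : Matching N D
    M₁ = let (d , d∈I , d∉D) = ⊑-proper D I critical-⊑ critical-proper in
         hall t₀ k N D (shrinks D d critical-⊑ d∈I d∉D) (hall-restrict {I = I} {D} hc critical-⊑)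
    M₁-in-N[D] : ∀ d → lookup D d ≡ true → neighbours N D (match M₁ d) ≡ true
    M₁-in-N[D] d d∈D = anyᶠ-intro _ d (∧≡true d∈D (match-edge M₁ d d∈D))
    M₂ : Matching (avoiding N (neighbours N D)) (I ∩ ∁ D)
    M₂ = let (d , d∈D) = critical-nonempty in
         hall t₀ k _ (I ∩ ∁ D)
           (shrinks (I ∩ ∁ D) d (∩∁⊑ I D) (critical-⊑ d d∈D) (trans (lookup-∩∁ I D d) (trans (cong (λ b → lookup I d ∧ not b) d∈D) (Boolₚ.∧-zeroʳ (lookup I d)))))
           (hall-beyond-critical N I D hc critical-⊑ critical-tight)
  ... | no no-critical = glue N I ⁅ i ⁆ (_=ᶠ t) (singleton-matching N i t Nit) (λ _ _ → =ᶠ-refl t) M₂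
    where
    t = proj₁ (neighbour N I i hc i∈I)
    Nit = proj₂ (neighbour N I i hc i∈I)
    i∉rest : lookup (I ∩ ∁ ⁅ i ⁆) i ≡ false
    i∉rest = trans (lookup-∩∁ I ⁅ i ⁆ i) (trans (cong (λ b → lookup I i ∧ not b) (trans (lookup-⁅⁆ i i) (=ᶠ-refl i))) (Boolₚ.∧-zeroʳ (lookup I i)))
    M₂ : Matching (avoiding N (_=ᶠ t)) (I ∩ ∁ ⁅ i ⁆)
    M₂ = hall t₀ k _ (I ∩ ∁ ⁅ i ⁆) (ℕₚ.≤-pred (ℕₚ.≤-trans (card-< (I ∩ ∁ ⁅ i ⁆) I i (∩∁⊑ I ⁅ i ⁆) i∈I i∉rest) size))
           (hall-beyond-loose N I i t i∈I no-critical)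

-- Colour sets, and the labels of R(Π) and R̄(R(Π)) they determine

disjoint : Subset n → Subset n → Bool
disjoint A X = allᶠ (λ c → not (lookup A c ∧ lookup X c))

disjoint-elim : (A X : Subset n) (c : Fin n) → disjoint A X ≡ true → lookup A c ≡ true → lookup X c ≡ false
disjoint-elim A X c e c∈A = not≡true (subst (λ b → not (b ∧ lookup X c) ≡ true) c∈A
  (allᶠ-elim (λ c → not (lookup A c ∧ lookup X c)) e c))

disjoint-intro : (A X : Subset n) → (∀ c → lookup A c ≡ true → lookup X c ≡ false) → disjoint A X ≡ true
disjoint-intro A X h = allᶠ-intro (λ c → not (lookup A c ∧ lookup X c)) pointwise
  where
  pointwise : ∀ c → not (lookup A c ∧ lookup X c) ≡ true
  pointwise c with lookup A c in e
  ... | true rewrite h c e = refl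
  ... | false = refl

disjoint-witness : (A X : Subset n) → disjoint A X ≡ false → ∃ λ c → lookup A c ≡ true × lookup X c ≡ true
disjoint-witness A X e =
  let (c , q) = allᶠ-counterexample (λ c → not (lookup A c ∧ lookup X c)) e
      both = not≡false q
  in c , ∧≡true-left both , ∧≡true-right both

disjoint-comm : (A X : Subset n) → disjoint A X ≡ disjoint X A
disjoint-comm A X with disjoint A X in e₁ | disjoint X A in e₂
... | true | true = refl
... | false | false = refl
... | true | false = let (c , x , a) = disjoint-witness X A e₂ in true≡false-elim (trans (sym x) (disjoint-elim A X c e₁ a))
... | false | true = let (c , a , x) = disjoint-witness A X e₁ in true≡false-elim (trans (sym a) (disjoint-elim X A c e₂ x))

disjoint-⊥ˡ : (X : Subset n) → disjoint ⊥ X ≡ true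
disjoint-⊥ˡ X = disjoint-intro ⊥ X (λ c e → true≡false-elim (trans (sym e) (lookup-⊥ c)))

disjoint-⊥ʳ : (X : Subset n) → disjoint X ⊥ ≡ true
disjoint-⊥ʳ X = trans (disjoint-comm X ⊥) (disjoint-⊥ˡ X)

disjoint-⊤ : (A : Subset n) (c : Fin n) → lookup A c ≡ true → disjoint A ⊤ ≡ false
disjoint-⊤ A c c∈A with disjoint A ⊤ in e
... | false = refl
... | true = true≡false-elim (trans (sym (lookup-⊤ c)) (disjoint-elim A ⊤ c e c∈A))

disjoint-∁ : (X : Subset n) → disjoint (∁ X) X ≡ true
disjoint-∁ X = disjoint-intro (∁ X) X (λ c e → not≡true (trans (sym (lookup-∁ X c)) e))

disjoint-⁅⁆ : (c : Fin n) (X : Subset n) → disjoint ⁅ c ⁆ X ≡ not (lookup X c)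
disjoint-⁅⁆ c X with lookup X c in c∈X
... | true = Boolₚ.¬-not (λ e → true≡false-elim (trans (sym c∈X)
               (disjoint-elim ⁅ c ⁆ X c e (trans (lookup-⁅⁆ c c) (=ᶠ-refl c)))))
... | false = disjoint-intro ⁅ c ⁆ X (λ d d∈ → subst (λ x → lookup X x ≡ false)
                (sym (=ᶠ⇒≡ d c (trans (sym (lookup-⁅⁆ c d)) d∈))) c∈X)

labelR : Subset n → Subset (2 ^ n)
labelR {n} X = setOf {n} (λ A → disjoint A X)

∈ᵇ-labelR : (X A : Subset n) → A ∈ᵇ labelR X ≡ disjoint A X
∈ᵇ-labelR {n} X A = ∈ᵇ-setOf {n} (λ A → disjoint A X) A

forbidden : Subset (2 ^ n) → Subset n
forbidden s = tabulate (λ c → not (⁅ c ⁆ ∈ᵇ s))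

forbidden-labelR : (X : Subset n) → forbidden (labelR X) ≡ X
forbidden-labelR X = trans
  (Vecₚ.tabulate-cong (λ c → trans (cong not (trans (∈ᵇ-labelR X ⁅ c ⁆) (disjoint-⁅⁆ c X))) (Boolₚ.not-involutive _)))
  (Vecₚ.tabulate∘lookup X)

isLabelRᵇ : Subset (2 ^ n) → Bool
isLabelRᵇ {n} s = s == labelR (forbidden {n} s)

isLabelRᵇ-labelR : (X : Subset n) → isLabelRᵇ {n} (labelR X) ≡ true
isLabelRᵇ-labelR {n} X = subst (λ Y → labelR X == labelR {n} Y ≡ true) (sym (forbidden-labelR X)) (==-refl (labelR X))

labelR̄R-test : Subset n → Subset (2 ^ n) → Bool
labelR̄R-test {n} C s = isLabelRᵇ {n} s ∧ disjoint (forbidden s) C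

labelR̄R : Subset n → Subset (2 ^ (2 ^ n))
labelR̄R {n} C = setOf {2 ^ n} (labelR̄R-test C)

∈ᵇ-labelR̄R⇒ : (C : Subset n) (s : Subset (2 ^ n)) → s ∈ᵇ labelR̄R C ≡ true →
               s ≡ labelR (forbidden {n} s) × disjoint (forbidden s) C ≡ true
∈ᵇ-labelR̄R⇒ {n} C s e =
  let both = trans (sym (∈ᵇ-setOf {2 ^ n} (labelR̄R-test C) s)) e
  in ==⇒≡ s _ (∧≡true-left both) , ∧≡true-right {isLabelRᵇ {n} s} both

∈ᵇ-labelR̄R : (C X : Subset n) → disjoint X C ≡ true → labelR X ∈ᵇ labelR̄R C ≡ true
∈ᵇ-labelR̄R {n} C X e = trans (∈ᵇ-setOf {2 ^ n} (labelR̄R-test C) (labelR X))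
  (∧≡true (isLabelRᵇ-labelR X) (trans (cong (λ Y → disjoint Y C) (forbidden-labelR X)) e))

-- the renaming R̄(R(Π)) → Π
decode : Subset (2 ^ (2 ^ n)) → Subset n
decode S = tabulate (λ c → not (labelR ⁅ c ⁆ ∈ᵇ S))

decode-labelR̄R : (C : Subset n) → decode (labelR̄R C) ≡ C
decode-labelR̄R {n} C = trans (Vecₚ.tabulate-cong at) (Vecₚ.tabulate∘lookup C)
  where
  at : ∀ c → not (labelR ⁅ c ⁆ ∈ᵇ labelR̄R C) ≡ lookup C c
  at c = begin
    not (labelR ⁅ c ⁆ ∈ᵇ labelR̄R C)
      ≡⟨ cong not (∈ᵇ-setOf {2 ^ n} (labelR̄R-test C) (labelR ⁅ c ⁆)) ⟩
    not (isLabelRᵇ {n} (labelR ⁅ c ⁆) ∧ disjoint (forbidden (labelR ⁅ c ⁆)) C)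
      ≡⟨ cong₂ (λ a Y → not (a ∧ disjoint Y C)) (isLabelRᵇ-labelR ⁅ c ⁆) (forbidden-labelR ⁅ c ⁆) ⟩
    not (disjoint ⁅ c ⁆ C)                ≡⟨ cong not (disjoint-⁅⁆ c C) ⟩
    not (not (lookup C c))                ≡⟨ Boolₚ.not-involutive _ ⟩
    lookup C c                            ∎
    where open ≡-Reasoning

fibre : (Fin n → Fin m) → Fin m → Subset n
fibre h j = tabulate (λ c → h c =ᶠ j)

lookup-fibre : (h : Fin n → Fin m) (j : Fin m) (c : Fin n) → lookup (fibre h j) c ≡ h c =ᶠ j
lookup-fibre h j c = Vecₚ.lookup∘tabulate (λ c → h c =ᶠ j) c

countΠ≡card : (D : Subset n) (C : Fin m → Subset n) → countΠ D C ≡ card (λ j → C j == D)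
countΠ≡card {m = zero} D C = refl
countΠ≡card {m = suc m} D C = cong ((if C zero == D then 1 else 0) +_) (countΠ≡card D (C ∘ suc))

-- The labels and hyperedge constraint of R(Π)

labelR-labelSet : (X : Subset Δ) → LabelSet (Π Δ r) (labelR X)
labelR-labelSet X = (λ _ _ → tt) , ⊥ , lookup⇒∈ (trans (∈ᵇ-labelR X ⊥) (disjoint-⊥ˡ X))

fibres-universal : (h : Fin Δ → Fin r) → AllChoices (Π Δ r) (Edge (Π Δ r)) (λ j → labelR (fibre h j))
fibres-universal h A A∈ i = h i , i∉A
  where
  i∉A : i ∉ A (h i)
  i∉A i∈A = true≡false-elim (trans (sym (trans (lookup-fibre h (h i) i) (=ᶠ-refl (h i))))
    (disjoint-elim (A (h i)) (fibre h (h i)) i (trans (sym (∈ᵇ-labelR (fibre h (h i)) (A (h i)))) (∈⇒lookup (A∈ (h i)))) (∈⇒lookup i∈A)))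

-- A universal configuration extending the fibre configuration adds nothing at position j: a set A
-- meeting h⁻¹(j) in i, placed at j next to the complements of the other fibres, would contain i everywhere.
fibres-bound : (h : Fin Δ → Fin r) (T : Fin r → Subset (2 ^ Δ)) → AllChoices (Π Δ r) (Edge (Π Δ r)) T →
               ((j : Fin r) → labelR (fibre h j) ⊆ₛ T j) →
               (j : Fin r) (A : Subset Δ) → A ∈ᵇ T j ≡ true → disjoint A (fibre h j) ≡ true
fibres-bound {Δ} {r} h T universal ⊇ j A A∈T with disjoint A (fibre h j) in e
... | true = refl
... | false = ⊥-elim (i-nowhere j′ i∉)
  where
  witness = disjoint-witness A (fibre h j) e
  i = proj₁ witness
  i∈A = proj₁ (proj₂ witness)
  hi≡j : h i ≡ j
  hi≡j = =ᶠ⇒≡ (h i) j (trans (sym (lookup-fibre h j i)) (proj₂ (proj₂ witness)))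
  choice : Fin r → Subset Δ
  choice j′ = if j′ =ᶠ j then A else ∁ (fibre h j′)
  choice∈T : ∀ j′ → choice j′ ∈ₛ T j′
  choice∈T j′ with j′ =ᶠ j in e′
  ... | true = subst (λ x → A ∈ₛ T x) (sym (=ᶠ⇒≡ j′ j e′)) (lookup⇒∈ A∈T)
  ... | false = ⊇ j′ (∁ (fibre h j′)) (lookup⇒∈ (trans (∈ᵇ-labelR (fibre h j′) _) (disjoint-∁ (fibre h j′))))
  j′ = proj₁ (universal choice choice∈T i)
  i∉ = proj₂ (universal choice choice∈T i)
  i-nowhere : ∀ j′ → i ∉ choice j′ → Data.Empty.⊥
  i-nowhere j′ i∉ with j′ =ᶠ j in e′
  ... | true = i∉ (lookup⇒∈ i∈A)
  ... | false = i∉ (lookup⇒∈ (trans (lookup-∁ (fibre h j′) i) (cong not (trans (lookup-fibre h j′ i) i-off))))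
    where
    i-off : h i =ᶠ j′ ≡ false
    i-off with h i =ᶠ j′ in e″
    ... | false = refl
    ... | true = true≡false-elim (trans (sym (subst (λ x → x =ᶠ j ≡ true) (trans (sym hi≡j) (=ᶠ⇒≡ (h i) j′ e″)) (=ᶠ-refl j))) e′)

fibres-maximal : (h : Fin Δ → Fin r) → MaxUniversal (Π Δ r) (Edge (Π Δ r)) (λ j → labelR (fibre h j))
fibres-maximal {Δ} {r} h = (λ j → labelR-labelSet {r = r} (fibre h j)) , fibres-universal h , maximal
  where
  maximal : (T : Fin r → Subset (2 ^ Δ)) → ((j : Fin r) → LabelSet (Π Δ r) (T j)) →
            AllChoices (Π Δ r) (Edge (Π Δ r)) T → ((j : Fin r) → labelR (fibre h j) ⊆ₛ T j) →
            (j : Fin r) → T j ≡ labelR (fibre h j)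
  maximal T _ universal ⊇ j = ∈ᵇ-ext (T j) (labelR (fibre h j)) pointwise
    where
    pointwise : (A : Subset Δ) → A ∈ᵇ T j ≡ A ∈ᵇ labelR (fibre h j)
    pointwise A with A ∈ᵇ T j in e
    ... | true = sym (trans (∈ᵇ-labelR (fibre h j) A) (fibres-bound h T universal ⊇ j A e))
    ... | false with A ∈ᵇ labelR (fibre h j) in e′
    ...   | false = refl
    ...   | true = true≡false-elim (trans (sym (∈⇒lookup (⊇ j A (lookup⇒∈ e′)))) e)

-- Every label of R(Π) is some labelR X: a maximal configuration T is dominated by the fibres of
-- "h c = the first position none of whose sets contains c", hence equal to them.
isLabelR⇒labelR : (s : Subset (2 ^ Δ)) → IsLabelR (Π Δ (suc r)) s → ∃ λ X → s ≡ labelR X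
isLabelR⇒labelR {Δ} {r} s (T , (_ , universal , maximal) , j₀ , Tj₀≡s) =
  fibre h j₀ , trans (sym Tj₀≡s) (sym (T≡fibres j₀))
  where
  occurs : Fin (suc r) → Fin Δ → Bool
  occurs j c = anyᵛ (λ A → A ∈ᵇ T j ∧ lookup A c)
  missing-somewhere : ∀ c → anyᶠ (λ j → not (occurs j c)) ≡ true
  missing-somewhere c with anyᶠ (λ j → not (occurs j c)) in e
  ... | true = refl
  ... | false = ⊥-elim (proj₂ missing (lookup⇒∈ (∧≡true-right (proj₂ (witness (proj₁ missing))))))
    where
    witness : ∀ j → ∃ λ A → A ∈ᵇ T j ∧ lookup A c ≡ true
    witness j = anyᵛ-witness _ (not≡false (anyᶠ≡false (λ j → not (occurs j c)) e j))
    missing = universal (proj₁ ∘ witness) (λ j → lookup⇒∈ (∧≡true-left (proj₂ (witness j)))) c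
  h : Fin Δ → Fin (suc r)
  h c = find (λ j → not (occurs j c))
  h-missing : ∀ c → occurs (h c) c ≡ false
  h-missing c = not≡true (find-satisfies (λ j → not (occurs j c)) (missing-somewhere c))
  T⊆fibres : (j : Fin (suc r)) → T j ⊆ₛ labelR (fibre h j)
  T⊆fibres j A A∈ = lookup⇒∈ (trans (∈ᵇ-labelR (fibre h j) A) (disjoint-intro A (fibre h j) λ c c∈A →
    trans (lookup-fibre h j c) (Boolₚ.¬-not (λ hc≡j → true≡false-elim (trans
      (sym (anyᵛ-intro (λ A → A ∈ᵇ T j ∧ lookup A c) A (∧≡true (∈⇒lookup A∈) c∈A)))
      (subst (λ x → occurs x c ≡ false) (=ᶠ⇒≡ (h c) j hc≡j) (h-missing c)))))))
  T≡fibres : ∀ j → labelR (fibre h j) ≡ T j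
  T≡fibres = let (labels , universal′ , _) = fibres-maximal h in maximal _ labels universal′ T⊆fibres

labelR-isLabelR : (X : Subset Δ) → IsLabelR (Π Δ (suc (suc r))) (labelR X)
labelR-isLabelR X = (λ j → labelR (fibre h j)) , fibres-maximal h , zero ,
                    cong labelR (trans (Vecₚ.tabulate-cong at-zero) (Vecₚ.tabulate∘lookup X))
  where
  h : Fin _ → Fin (suc (suc _))
  h c = if lookup X c then zero else suc zero
  at-zero : ∀ c → h c =ᶠ zero ≡ lookup X c
  at-zero c with lookup X c
  ... | true = refl
  ... | false = refl

m∸n+1+[n∸1]≡m : ∀ {m n} → 1 ≤ n → n ≤ m → (m ∸ n + 1) + (n ∸ 1) ≡ m
m∸n+1+[n∸1]≡m {m} {suc n} _ n≤m = trans (ℕₚ.+-assoc (m ∸ suc n) 1 n) (ℕₚ.m∸n+n≡m n≤m)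

∸-cancelˡ-≤ : ∀ {m n o} → n ≤ m → m ∸ o ≤ m ∸ n → n ≤ o
∸-cancelˡ-≤ n≤m h = ℕₚ.≮⇒≥ (λ o<n → ℕₚ.<⇒≱ (ℕₚ.∸-monoʳ-< o<n n≤m) h)

n+1≰n : ∀ {n} → ¬ n + 1 ≤ n
n+1≰n {n} h = ℕₚ.1+n≰n (subst (_≤ n) (ℕₚ.+-comm n 1) h)

card≡n : (p : Fin n → Bool) → card p ≡ n → ∀ j → p j ≡ true
card≡n {n} p e j = not≡false (card≡0 (not ∘ p) none j)
  where
  none : card (not ∘ p) ≡ 0
  none = ℕₚ.+-cancelˡ-≡ n _ _ (trans (cong (_+ card (not ∘ p)) (sym e))
           (trans (card+card-not≡n p) (sym (ℕₚ.+-identityʳ n))))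

⊆-card-⊇ : {p q : Subset n} → p ⊆ q → ∣ q ∣ ≤ ∣ p ∣ → q ⊆ p
⊆-card-⊇ {p = p} {q} p⊆q ∣q∣≤∣p∣ {c} c∈q with c Subsetₚ.∈? p
... | yes c∈p = c∈p
... | no c∉p = ⊥-elim (ℕₚ.<⇒≱ (Subsetₚ.p⊂q⇒∣p∣<∣q∣ (p⊆q , c , c∈q , c∉p)) ∣q∣≤∣p∣)

nonempty⇒∣∣≥1 : (D : Subset n) → Nonempty D → 1 ≤ ∣ D ∣
nonempty⇒∣∣≥1 D (c , c∈D) = subst (1 ≤_) (sym (∣∣≡card D)) (card-pos (lookup D) c (∈⇒lookup c∈D))

node-entries : (C : Fin Δ → Subset Δ) (D : Subset Δ) → Nonempty D →
               countΠ D C ≡ Δ ∸ ∣ D ∣ + 1 → countΠ ⊥ C ≡ ∣ D ∣ ∸ 1 → ∀ j → C j ≡ D ⊎ C j ≡ ⊥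
node-entries {Δ} C D nonempty@(c , c∈D) countD count⊥ j =
  entry (C j == D) (C j == ⊥) refl refl (card≡n (λ j → (C j == D) ∨ (C j == ⊥)) total j)
  where
  entry : ∀ a b → C j == D ≡ a → C j == ⊥ ≡ b → a ∨ b ≡ true → C j ≡ D ⊎ C j ≡ ⊥
  entry true _ e _ _ = inj₁ (==⇒≡ _ _ e)
  entry false true _ e _ = inj₂ (==⇒≡ _ _ e)
  D≢⊥ : D ≢ ⊥
  D≢⊥ D≡⊥ = true≡false-elim (trans (sym (∈⇒lookup c∈D)) (trans (cong (λ Y → lookup Y c) D≡⊥) (lookup-⊥ c)))
  only-D : ∀ j → (C j == D) ∧ not (C j == ⊥) ≡ (C j == D)
  only-D j with C j == D in e
  ... | true = cong not (≢⇒==false (C j) ⊥ (λ Cj≡⊥ → D≢⊥ (trans (sym (==⇒≡ _ _ e)) Cj≡⊥)))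
  ... | false = refl
  total : card (λ j → (C j == D) ∨ (C j == ⊥)) ≡ Δ
  total = begin
    card (λ j → (C j == D) ∨ (C j == ⊥))                              ≡⟨ card-∨ (λ j → C j == D) (λ j → C j == ⊥) ⟩
    card (λ j → (C j == D) ∧ not (C j == ⊥)) + card (λ j → C j == ⊥)   ≡⟨ cong₂ _+_
      (trans (card-cong only-D) (trans (sym (countΠ≡card D C)) countD)) (trans (sym (countΠ≡card ⊥ C)) count⊥) ⟩
    (Δ ∸ ∣ D ∣ + 1) + (∣ D ∣ ∸ 1)                                        ≡⟨ m∸n+1+[n∸1]≡m (nonempty⇒∣∣≥1 D nonempty) (Subsetₚ.∣p∣≤n D) ⟩
    Δ                                                                   ∎
    where open ≡-Reasoning

blocker : (C : Fin Δ → Subset Δ) (D X : Subset Δ) (j j′ : Fin Δ) → Subset Δ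
blocker C D X j j′ = if j′ =ᶠ j then X else (if C j′ == D then ∁ D else ⊤)

-- Off j, a copy of D′ must sit where C has D and inside D; so D′ has at most Δ-∣D∣ copies off j.
-- Without a copy at j this undercounts; with one, D′ avoids X, yet the count forces D ⊆ D′.
no-node-avoids-blockers :
  (C : Fin Δ → Subset Δ) (D X : Subset Δ) (j : Fin Δ) → C j == D ≡ true → disjoint X D ≡ false →
  countΠ D C ≡ Δ ∸ ∣ D ∣ + 1 → (A : Fin Δ → Subset Δ) →
  (∀ j′ → disjoint (A j′) (blocker C D X j j′) ≡ true) → ¬ Node (Π Δ r) A
no-node-avoids-blockers {Δ} C D X j Cj≡D X∩D≢∅ countD A avoids (D′ , (c₁ , c₁∈D′) , countD′ , _) =
  by-cases (p j) refl
  where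
  p q rest-p rest-q : Fin Δ → Bool
  p j′ = A j′ == D′
  q j′ = C j′ == D
  rest-p j′ = p j′ ∧ not (j′ =ᶠ j)
  rest-q j′ = q j′ ∧ not (j′ =ᶠ j)

  D′-avoids : ∀ j′ → p j′ ≡ true → disjoint D′ (blocker C D X j j′) ≡ true
  D′-avoids j′ pj′ = subst (λ Y → disjoint Y (blocker C D X j j′) ≡ true) (==⇒≡ _ _ pj′) (avoids j′)

  elsewhere : ∀ j′ → j′ =ᶠ j ≡ false → p j′ ≡ true → q j′ ≡ true × D′ ⊆ D
  elsewhere j′ j′≢j pj′ with q j′ in e
    | subst (λ b → disjoint D′ (if b then X else (if q j′ then ∁ D else ⊤)) ≡ true) j′≢j (D′-avoids j′ pj′)
  ... | true | D′∩∁D≡∅ = refl , λ {c} c∈D′ → lookup⇒∈ (not≡false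
          (trans (sym (lookup-∁ D c)) (disjoint-elim D′ (∁ D) c D′∩∁D≡∅ (∈⇒lookup c∈D′))))
  ... | false | D′∩⊤≡∅ = true≡false-elim (trans (sym D′∩⊤≡∅) (disjoint-⊤ D′ c₁ (∈⇒lookup c₁∈D′)))

  off-j : ∀ j′ → rest-p j′ ≡ true → j′ =ᶠ j ≡ false
  off-j j′ e = not≡true (∧≡true-right {p j′} e)

  rest-p≤rest-q : card rest-p ≤ card rest-q
  rest-p≤rest-q = card-mono (λ j′ e → ∧≡true (proj₁ (elsewhere j′ (off-j j′ e) (∧≡true-left e))) (∧≡true-right {p j′} e))

  rest-q≡ : card rest-q ≡ Δ ∸ ∣ D ∣
  rest-q≡ = ℕₚ.+-cancelʳ-≡ 1 _ _ (begin
    card rest-q + 1                               ≡⟨ cong (λ b → card rest-q + (if b then 1 else 0)) Cj≡D ⟨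
    card rest-q + (if q j then 1 else 0)          ≡⟨ card-remove q j ⟨
    card q                                        ≡⟨ countΠ≡card D C ⟨
    countΠ D C                                    ≡⟨ countD ⟩
    Δ ∸ ∣ D ∣ + 1                                 ∎)
    where open ≡-Reasoning

  split : Δ ∸ ∣ D′ ∣ + 1 ≡ card rest-p + (if p j then 1 else 0)
  split = trans (sym countD′) (trans (countΠ≡card D′ A) (card-remove p j))

  D′⊆D : 1 ≤ card rest-p → D′ ⊆ D
  D′⊆D h = let (j′ , e) = card≥1 rest-p h in proj₂ (elsewhere j′ (off-j j′ e) (∧≡true-left e))

  by-cases : ∀ b → p j ≡ b → Data.Empty.⊥
  by-cases false pj = n+1≰n (begin
    Δ ∸ ∣ D′ ∣ + 1          ≡⟨ only-rest ⟩
    card rest-p             ≤⟨ rest-p≤rest-q ⟩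
    card rest-q             ≡⟨ rest-q≡ ⟩
    Δ ∸ ∣ D ∣               ≤⟨ ℕₚ.∸-monoʳ-≤ Δ (Subsetₚ.p⊆q⇒∣p∣≤∣q∣ (D′⊆D (subst (1 ≤_) only-rest (ℕₚ.m≤n+m 1 _)))) ⟩
    Δ ∸ ∣ D′ ∣              ∎)
    where
    open ℕₚ.≤-Reasoning
    only-rest : Δ ∸ ∣ D′ ∣ + 1 ≡ card rest-p
    only-rest = trans split (trans (cong (λ b → card rest-p + (if b then 1 else 0)) pj) (ℕₚ.+-identityʳ _))
  by-cases true pj = c∉D′ (D⊆D′ c∈D)
    where
    witness = disjoint-witness X D X∩D≢∅
    c = proj₁ witness
    c∈D : c ∈ D
    c∈D = lookup⇒∈ (proj₂ (proj₂ witness))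
    D′∩X≡∅ : disjoint D′ X ≡ true
    D′∩X≡∅ = subst (λ b → disjoint D′ (if b then X else (if q j then ∁ D else ⊤)) ≡ true) (=ᶠ-refl j) (D′-avoids j pj)
    c∉D′ : c ∉ D′
    c∉D′ c∈D′ = true≡false-elim (trans (sym (proj₁ (proj₂ witness))) (disjoint-elim D′ X c D′∩X≡∅ (∈⇒lookup c∈D′)))
    rest-p≡ : card rest-p ≡ Δ ∸ ∣ D′ ∣
    rest-p≡ = ℕₚ.+-cancelʳ-≡ 1 _ _ (trans (cong (λ b → card rest-p + (if b then 1 else 0)) (sym pj)) (sym split))
    D⊆D′ : D ⊆ D′
    D⊆D′ with card rest-p in e
    ... | zero = λ _ → subst (_ ∈_) (sym D′≡⊤) Subsetₚ.∈⊤
      where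
      D′≡⊤ : D′ ≡ ⊤
      D′≡⊤ = Subsetₚ.∣p∣≡n⇒p≡⊤ (ℕₚ.≤-antisym (Subsetₚ.∣p∣≤n D′) (ℕₚ.m∸n≡0⇒m≤n (trans (sym rest-p≡) e)))
    ... | suc _ = ⊆-card-⊇ D′-inside-D (∸-cancelˡ-≤ (Subsetₚ.∣p∣≤n D) (begin
      Δ ∸ ∣ D′ ∣              ≡⟨ rest-p≡ ⟨
      card rest-p             ≤⟨ rest-p≤rest-q ⟩
      card rest-q             ≡⟨ rest-q≡ ⟩
      Δ ∸ ∣ D ∣               ∎))
      where
      open ℕₚ.≤-Reasoning
      D′-inside-D : D′ ⊆ D
      D′-inside-D = D′⊆D (subst (1 ≤_) (sym e) (s≤s z≤n))

-- Node configurations of Π give maximal node configurations of R(Π)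

labelR̄R-labelSet : (C : Subset Δ) → LabelSet (R (Π Δ (suc (suc r)))) (labelR̄R C)
labelR̄R-labelSet {Δ} {r} C =
  (λ s s∈ → subst (IsLabelR (Π _ (suc (suc r)))) (sym (proj₁ (∈ᵇ-labelR̄R⇒ C s (∈⇒lookup s∈)))) (labelR-isLabelR (forbidden s))) ,
  labelR (⊥ {Δ}) , lookup⇒∈ (∈ᵇ-labelR̄R C ⊥ (disjoint-⊥ˡ C))

∈labelR̄R⇒∋ : (C : Subset Δ) (s : Subset (2 ^ Δ)) → s ∈ₛ labelR̄R C → C ∈ₛ s
∈labelR̄R⇒∋ C s s∈ =
  let (s≡ , disj) = ∈ᵇ-labelR̄R⇒ C s (∈⇒lookup s∈) in
  lookup⇒∈ (trans (cong (C ∈ᵇ_) s≡) (trans (∈ᵇ-labelR (forbidden s) C) (trans (disjoint-comm C (forbidden s)) disj)))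

-- T ⊇ labelR̄R ∘ C universal: a set s ∈ T j is labelR X with X ∩ C j = ∅, since otherwise
-- choosing the blockers of X next to it would leave no node configuration.
labelR̄R-bound :
  (C : Fin Δ → Subset Δ) → Node (Π Δ (suc (suc r))) C → (T : Fin Δ → Subset (2 ^ (2 ^ Δ))) →
  (∀ j → LabelSet (R (Π Δ (suc (suc r)))) (T j)) → AllChoices (R (Π Δ (suc (suc r)))) (Node (R (Π Δ (suc (suc r))))) T →
  (∀ j → labelR̄R (C j) ⊆ₛ T j) → ∀ j s → s ∈ᵇ T j ≡ true → s ∈ᵇ labelR̄R (C j) ≡ true
labelR̄R-bound {Δ} {r} C (D , nonempty , countD , count⊥) T labels universal ⊇ j s s∈T =
  let (X , s≡) = isLabelR⇒labelR s (proj₁ (labels j) s (lookup⇒∈ s∈T)) in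
  subst (λ s → s ∈ᵇ labelR̄R (C j) ≡ true) (sym s≡) (∈ᵇ-labelR̄R (C j) X (fits X (subst (λ s → s ∈ᵇ T j ≡ true) s≡ s∈T)))
  where
  entries = node-entries C D nonempty countD count⊥
  fits : (X : Subset Δ) → labelR X ∈ᵇ T j ≡ true → disjoint X (C j) ≡ true
  fits X X∈T with disjoint X (C j) in e
  ... | true = refl
  ... | false = ⊥-elim (no-node-avoids-blockers {r = suc (suc r)} C D X j Cj==D X∩D≢∅ countD A avoids nodeA)
    where
    Cj≡D : C j ≡ D
    Cj≡D with entries j
    ... | inj₁ Cj≡D = Cj≡D
    ... | inj₂ Cj≡⊥ = true≡false-elim (trans (sym (disjoint-⊥ʳ X)) (trans (cong (disjoint X) (sym Cj≡⊥)) e))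
    Cj==D : C j == D ≡ true
    Cj==D = subst (λ Y → Y == D ≡ true) (sym Cj≡D) (==-refl D)
    X∩D≢∅ : disjoint X D ≡ false
    X∩D≢∅ = subst (λ Y → disjoint X Y ≡ false) Cj≡D e
    choice∈T : ∀ j′ → labelR (blocker C D X j j′) ∈ₛ T j′
    choice∈T j′ with j′ =ᶠ j in e₁
    ... | true = subst (λ x → labelR X ∈ₛ T x) (sym (=ᶠ⇒≡ j′ j e₁)) (lookup⇒∈ X∈T)
    ... | false with C j′ == D in e₂
    ...   | true = ⊇ j′ (labelR (∁ D)) (lookup⇒∈ (∈ᵇ-labelR̄R (C j′) (∁ D)
                     (subst (λ Y → disjoint (∁ D) Y ≡ true) (sym (==⇒≡ _ _ e₂)) (disjoint-∁ D))))
    ...   | false = ⊇ j′ (labelR (⊤ {Δ})) (lookup⇒∈ (∈ᵇ-labelR̄R (C j′) ⊤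
                     (subst (λ Y → disjoint ⊤ Y ≡ true) (sym Cj′≡⊥) (disjoint-⊥ʳ (⊤ {Δ})))))
      where
      Cj′≡⊥ : C j′ ≡ ⊥
      Cj′≡⊥ with entries j′
      ... | inj₁ Cj′≡D = true≡false-elim (trans (sym (subst (λ Y → Y == D ≡ true) (sym Cj′≡D) (==-refl D))) e₂)
      ... | inj₂ Cj′≡⊥ = Cj′≡⊥
    chosen = proj₂ (universal (λ j′ → labelR (blocker C D X j j′)) choice∈T)
    A = proj₁ chosen
    avoids : ∀ j′ → disjoint (A j′) (blocker C D X j j′) ≡ true
    avoids j′ = trans (sym (∈ᵇ-labelR (blocker C D X j j′) (A j′))) (∈⇒lookup (proj₁ (proj₂ chosen) j′))
    nodeA = proj₂ (proj₂ chosen)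

labelR̄R-node-maximal : (C : Fin Δ → Subset Δ) → Node (Π Δ (suc (suc r))) C →
                       MaxUniversal (R (Π Δ (suc (suc r)))) (Node (R (Π Δ (suc (suc r))))) (labelR̄R ∘ C)
labelR̄R-node-maximal {Δ} {r} C node =
  (λ j → labelR̄R-labelSet (C j)) , universal , λ T labels universal′ ⊇ j →
    ∈ᵇ-ext (T j) (labelR̄R (C j)) (pointwise T labels universal′ ⊇ j)
  where
  universal : AllChoices (R (Π Δ (suc (suc r)))) (Node (R (Π Δ (suc (suc r))))) (labelR̄R ∘ C)
  universal s s∈ = (λ j → proj₁ (labelR̄R-labelSet (C j)) (s j) (s∈ j)) , C , (λ j → ∈labelR̄R⇒∋ (C j) (s j) (s∈ j)) , node
  pointwise : (T : Fin Δ → Subset (2 ^ (2 ^ Δ))) → (∀ j → LabelSet (R (Π Δ (suc (suc r)))) (T j)) →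
              AllChoices (R (Π Δ (suc (suc r)))) (Node (R (Π Δ (suc (suc r))))) T → (∀ j → labelR̄R (C j) ⊆ₛ T j) →
              ∀ j (s : Subset (2 ^ Δ)) → s ∈ᵇ T j ≡ s ∈ᵇ labelR̄R (C j)
  pointwise T labels universal′ ⊇ j s with s ∈ᵇ labelR̄R (C j) in e
  ... | true = ∈⇒lookup (⊇ j s (lookup⇒∈ e))
  ... | false with s ∈ᵇ T j in e′
  ...   | false = refl
  ...   | true = true≡false-elim (trans (sym (labelR̄R-bound C node T labels universal′ ⊇ j s e′)) e)

-- Maximal node configurations of R(Π) come from node configurations of Π

place : Subset Δ → (Fin Δ → Bool) → Fin Δ → Subset Δ
place D sl j = if sl j then D else ⊥

place-node : (D : Subset Δ) → Nonempty D → (sl : Fin Δ → Bool) → card sl ≡ Δ ∸ ∣ D ∣ + 1 →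
             Node (Π Δ r) (place D sl)
place-node {Δ} D nonempty@(c , c∈D) sl card-sl =
  D , nonempty , trans (countΠ≡card D (place D sl)) (trans (card-cong at-D) card-sl) ,
  trans (countΠ≡card ⊥ (place D sl)) (trans (card-cong at-⊥) card-not-sl)
  where
  D≢⊥ : D ≢ ⊥
  D≢⊥ D≡⊥ = true≡false-elim (trans (sym (∈⇒lookup c∈D)) (trans (cong (λ Y → lookup Y c) D≡⊥) (lookup-⊥ c)))
  at-D : ∀ j → place D sl j == D ≡ sl j
  at-D j with sl j
  ... | true = ==-refl D
  ... | false = ≢⇒==false ⊥ D (D≢⊥ ∘ sym)
  at-⊥ : ∀ j → place D sl j == ⊥ ≡ not (sl j)
  at-⊥ j with sl j
  ... | true = ≢⇒==false D ⊥ D≢⊥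
  ... | false = ==-refl ⊥
  card-not-sl : card (not ∘ sl) ≡ ∣ D ∣ ∸ 1
  card-not-sl = ℕₚ.+-cancelˡ-≡ (Δ ∸ ∣ D ∣ + 1) _ _
    (trans (subst (λ x → x + card (not ∘ sl) ≡ Δ) card-sl (card+card-not≡n sl))
           (sym (m∸n+1+[n∸1]≡m (nonempty⇒∣∣≥1 D nonempty) (Subsetₚ.∣p∣≤n D))))

image : (Fin n → Fin m) → (Fin n → Bool) → Fin m → Bool
image g D j = anyᶠ (λ d → D d ∧ (g d =ᶠ j))

card-image : (g : Fin n → Fin m) → (∀ d e → g d ≡ g e → d ≡ e) → (D : Fin n → Bool) → card D ≤ card (image g D)
card-image {zero} g inj D = z≤n
card-image {suc n} g inj D = step (D zero) refl
  where
  open ℕₚ.≤-Reasoning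
  IH : card (D ∘ suc) ≤ card (image (g ∘ suc) (D ∘ suc))
  IH = card-image (g ∘ suc) (λ d e q → Finₚ.suc-injective (inj _ _ q)) (D ∘ suc)
  image-tail : ∀ j → image (g ∘ suc) (D ∘ suc) j ≡ true → image g D j ≡ true
  image-tail j h = trans (cong (D zero ∧ (g zero =ᶠ j) ∨_) h) (Boolₚ.∨-zeroʳ _)
  card-D : ∀ b → D zero ≡ b → card D ≡ (if b then 1 else 0) + card (D ∘ suc)
  card-D b e = cong (λ b → (if b then 1 else 0) + card (D ∘ suc)) e
  off-g0 : ∀ j → image (g ∘ suc) (D ∘ suc) j ≡ true → image g D j ∧ not (j =ᶠ g zero) ≡ true
  off-g0 j h with j =ᶠ g zero in e
  ... | false = ∧≡true (image-tail j h) refl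
  ... | true = let (d , q) = anyᶠ-witness _ h in
    ⊥-elim (Finₚ.0≢1+n (sym (inj (suc d) zero (trans (=ᶠ⇒≡ _ j (∧≡true-right {D (suc d)} q)) (=ᶠ⇒≡ j (g zero) e)))))
  step : ∀ b → D zero ≡ b → card D ≤ card (image g D)
  step false e = begin
    card D                                  ≡⟨ card-D false e ⟩
    card (D ∘ suc)                          ≤⟨ IH ⟩
    card (image (g ∘ suc) (D ∘ suc))        ≤⟨ card-mono image-tail ⟩
    card (image g D)                        ∎
  step true e = begin
    card D                                                    ≡⟨ card-D true e ⟩
    suc (card (D ∘ suc))                                      ≤⟨ s≤s (ℕₚ.≤-trans IH (card-mono off-g0)) ⟩
    suc (card (λ j → image g D j ∧ not (j =ᶠ g zero)))        ≡⟨ ℕₚ.+-comm 1 _ ⟩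
    card (λ j → image g D j ∧ not (j =ᶠ g zero)) + 1          ≡⟨ cong (λ b → card (λ j → image g D j ∧ not (j =ᶠ g zero)) + (if b then 1 else 0)) g0∈image ⟨
    card (λ j → image g D j ∧ not (j =ᶠ g zero)) + (if image g D (g zero) then 1 else 0) ≡⟨ card-remove (image g D) (g zero) ⟨
    card (image g D)                                          ∎
    where
    g0∈image : image g D (g zero) ≡ true
    g0∈image = anyᶠ-intro (λ d → D d ∧ (g d =ᶠ g zero)) zero (∧≡true e (=ᶠ-refl (g zero)))

-- D′ cannot occupy any of the ∣ D′ ∣ positions g(D′), leaving too few for its copies.
no-node-avoiding-injection : (A : Fin Δ → Subset Δ) (g : Fin Δ → Fin Δ) → (∀ d e → g d ≡ g e → d ≡ e) →
                             (∀ d → lookup (A (g d)) d ≡ false) → ¬ Node (Π Δ r) A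
no-node-avoiding-injection {Δ} A g inj avoid (D′ , _ , countD′ , _) = n+1≰n (begin
  Δ ∸ ∣ D′ ∣ + 1                         ≡⟨ countD′ ⟨
  countΠ D′ A                            ≡⟨ countΠ≡card D′ A ⟩
  card (λ j → A j == D′)                 ≤⟨ card-mono copies-outside-image ⟩
  card (not ∘ image g (lookup D′))       ≡⟨ ℕₚ.m+n∸m≡n (card (image g (lookup D′))) _ ⟨
  card (image g (lookup D′)) + card (not ∘ image g (lookup D′)) ∸ card (image g (lookup D′))
                                         ≡⟨ cong (_∸ card (image g (lookup D′))) (card+card-not≡n (image g (lookup D′))) ⟩
  Δ ∸ card (image g (lookup D′))         ≤⟨ ℕₚ.∸-monoʳ-≤ Δ (subst (_≤ card (image g (lookup D′))) (sym (∣∣≡card D′)) (card-image g inj (lookup D′))) ⟩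
  Δ ∸ ∣ D′ ∣                             ∎)
  where
  open ℕₚ.≤-Reasoning
  copies-outside-image : ∀ j → A j == D′ ≡ true → not (image g (lookup D′) j) ≡ true
  copies-outside-image j Aj==D′ with image g (lookup D′) j in e
  ... | false = refl
  ... | true = let (d , q) = anyᶠ-witness _ e
                   gd≡j = =ᶠ⇒≡ (g d) j (∧≡true-right {lookup D′ d} q)
               in true≡false-elim (trans (sym (∧≡true-left q))
                    (trans (cong (λ Y → lookup Y d) (sym (==⇒≡ _ _ Aj==D′)))
                      (subst (λ x → lookup (A x) d ≡ false) gd≡j (avoid d))))

forbids : (T : Fin Δ → Subset (2 ^ (2 ^ Δ))) → Fin Δ → Fin Δ → Bool
forbids {Δ} T d j = anyᵛ (λ X → labelR {Δ} X ∈ᵇ T j ∧ lookup X d)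

-- Matching every colour d to a position g d with some labelR X_d ∋ d in T (g d), and choosing
-- labelR X_d there, forces every node configuration to miss d at g d.
hall⇒no-node :
  (T : Fin Δ → Subset (2 ^ (2 ^ Δ))) → (∀ j → LabelSet (R (Π Δ (suc (suc r)))) (T j)) →
  AllChoices (R (Π Δ (suc (suc r)))) (Node (R (Π Δ (suc (suc r))))) T →
  ¬ HallCondition (forbids T) ⊤
hall⇒no-node {zero} T labels universal hc with universal (λ ()) (λ ())
... | _ , _ , _ , _ , (() , _) , _
hall⇒no-node {Δ@(suc _)} {r} T labels universal hc =
  no-node-avoiding-injection {r = suc (suc r)} A g g-injective avoid nodeA
  where
  M : Matching (forbids T) ⊤
  M = hall zero Δ (forbids T) ⊤ (card≤n (lookup ⊤)) hc
  g = match M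
  g-injective : ∀ d e → g d ≡ g e → d ≡ e
  g-injective d e = match-injective M d e (lookup-⊤ d) (lookup-⊤ e)
  X : Fin Δ → Subset Δ
  X d = proj₁ (anyᵛ-witness (λ X → labelR {Δ} X ∈ᵇ T (g d) ∧ lookup X d) (match-edge M d (lookup-⊤ d)))
  X-spec : ∀ d → labelR (X d) ∈ᵇ T (g d) ∧ lookup (X d) d ≡ true
  X-spec d = proj₂ (anyᵛ-witness (λ X → labelR {Δ} X ∈ᵇ T (g d) ∧ lookup X d) (match-edge M d (lookup-⊤ d)))
  matched : Fin Δ → Bool
  matched j = anyᶠ (λ d → g d =ᶠ j)
  choice : Fin Δ → Subset (2 ^ Δ)
  choice j = if matched j then labelR (X (find (λ d → g d =ᶠ j))) else proj₁ (proj₂ (labels j))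
  preimage : ∀ d → find (λ d′ → g d′ =ᶠ g d) ≡ d
  preimage d = g-injective _ d (=ᶠ⇒≡ _ _ (find-satisfies (λ d′ → g d′ =ᶠ g d) (anyᶠ-intro (λ d′ → g d′ =ᶠ g d) d (=ᶠ-refl (g d)))))
  choice∈T : ∀ j → choice j ∈ₛ T j
  choice∈T j with matched j in e
  ... | true = let d = find (λ d → g d =ᶠ j) in
    subst (λ x → labelR (X d) ∈ₛ T x) (=ᶠ⇒≡ (g d) j (find-satisfies (λ d → g d =ᶠ j) e)) (lookup⇒∈ (∧≡true-left (X-spec d)))
  ... | false = proj₂ (proj₂ (labels j))
  chosen = proj₂ (universal choice choice∈T)
  A = proj₁ chosen
  nodeA = proj₂ (proj₂ chosen)
  avoid : ∀ d → lookup (A (g d)) d ≡ false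
  avoid d = disjoint-elim (X d) (A (g d)) d
    (trans (disjoint-comm (X d) (A (g d))) (trans (sym (∈ᵇ-labelR (X d) (A (g d))))
      (subst (λ s → A (g d) ∈ᵇ s ≡ true) at-gd (∈⇒lookup (proj₁ (proj₂ chosen) (g d))))))
    (∧≡true-right {labelR (X d) ∈ᵇ T (g d)} (X-spec d))
    where
    at-gd : choice (g d) ≡ labelR (X d)
    at-gd = trans (cong (λ b → if b then labelR (X (find (λ d′ → g d′ =ᶠ g d))) else proj₁ (proj₂ (labels (g d))))
                        (anyᶠ-intro (λ d′ → g d′ =ᶠ g d) d (=ᶠ-refl (g d))))
                  (cong (labelR ∘ X) (preimage d))

[m+n]∸o+1≤n : ∀ m n o → m + 1 ≤ o → o ≤ m + n → (m + n) ∸ o + 1 ≤ n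
[m+n]∸o+1≤n zero (suc n) (suc o) _ o≤n =
  subst (n ∸ o + 1 ≤_) (ℕₚ.+-comm n 1) (ℕₚ.+-monoˡ-≤ 1 (ℕₚ.m∸n≤m n o))
[m+n]∸o+1≤n (suc m) n (suc o) (s≤s m+1≤o) (s≤s o≤m+n) = [m+n]∸o+1≤n m n o m+1≤o o≤m+n

-- If the colours of D can reach fewer than ∣ D ∣ positions, then more than Δ - ∣ D ∣ positions admit
-- only sets disjoint from D; putting D on Δ - ∣ D ∣ + 1 of them gives a node configuration
-- dominating T, hence equal to it.
deficient-placement :
  (T : Fin Δ → Subset (2 ^ (2 ^ Δ))) → MaxUniversal (R (Π Δ (suc (suc r)))) (Node (R (Π Δ (suc (suc r))))) T →
  (D : Subset Δ) → suc (card (neighbours (forbids T) D)) ≤ card (lookup D) →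
  Σ (Fin Δ → Subset Δ) λ C → Node (Π Δ (suc (suc r))) C × (∀ j → T j ≡ labelR̄R (C j))
deficient-placement {Δ} {r} T (labels , _ , maximal) D deficient = place D sl , node , λ j → sym (T≡ j)
  where
  free : Fin Δ → Bool
  free j = not (neighbours (forbids T) D j)
  reached = card (neighbours (forbids T) D)
  enough-free : Δ ∸ ∣ D ∣ + 1 ≤ card free
  enough-free = subst (λ x → x ∸ ∣ D ∣ + 1 ≤ card free) (card+card-not≡n (neighbours (forbids T) D))
    ([m+n]∸o+1≤n reached (card free) ∣ D ∣
      (subst₂ _≤_ (ℕₚ.+-comm 1 reached) (sym (∣∣≡card D)) deficient)
      (subst (_≤ reached + card free) (sym (∣∣≡card D))
        (subst (card (lookup D) ≤_) (sym (card+card-not≡n (neighbours (forbids T) D))) (card≤n (lookup D)))))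
  sl : Fin Δ → Bool
  sl = select free (Δ ∸ ∣ D ∣ + 1)
  nonempty : Nonempty D
  nonempty = let (c , e) = card≥1 (lookup D) (ℕₚ.≤-trans (s≤s z≤n) deficient) in c , lookup⇒∈ e
  node : Node (Π Δ (suc (suc r))) (place D sl)
  node = place-node {r = suc (suc r)} D nonempty sl (card-select free _ enough-free)
  fits : ∀ j (X : Subset Δ) → labelR X ∈ᵇ T j ≡ true → disjoint X (if sl j then D else ⊥) ≡ true
  fits j X X∈T with sl j in e
  ... | false = disjoint-⊥ʳ X
  ... | true = disjoint-intro X D outside-D
    where
    outside-D : ∀ c → lookup X c ≡ true → lookup D c ≡ false
    outside-D c c∈X = Boolₚ.¬-not (λ c∈D → true≡false-elim (trans
      (sym (anyᶠ-intro (λ d → lookup D d ∧ forbids T d j) c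
        (∧≡true c∈D (anyᵛ-intro (λ X → labelR X ∈ᵇ T j ∧ lookup X c) X (∧≡true X∈T c∈X)))))
      (not≡true (select⊆ free (Δ ∸ ∣ D ∣ + 1) j e))))
  T⊆ : ∀ j → T j ⊆ₛ labelR̄R (place D sl j)
  T⊆ j s s∈ =
    let (X , s≡) = isLabelR⇒labelR s (proj₁ (labels j) s s∈) in
    subst (_∈ₛ labelR̄R (place D sl j)) (sym s≡)
      (lookup⇒∈ (∈ᵇ-labelR̄R (place D sl j) X (fits j X (subst (λ s → s ∈ᵇ T j ≡ true) s≡ (∈⇒lookup s∈)))))
  T≡ : ∀ j → labelR̄R (place D sl j) ≡ T j
  T≡ = let (labels′ , universal′ , _) = labelR̄R-node-maximal (place D sl) node in maximal _ labels′ universal′ T⊆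

-- Either some set of colours is deficient, or Hall's theorem yields the contradiction of hall⇒no-node.
maximal-node-labelR̄R :
  (T : Fin Δ → Subset (2 ^ (2 ^ Δ))) → MaxUniversal (R (Π Δ (suc (suc r)))) (Node (R (Π Δ (suc (suc r))))) T →
  Σ (Fin Δ → Subset Δ) λ C → Node (Π Δ (suc (suc r))) C × (∀ j → T j ≡ labelR̄R (C j))
maximal-node-labelR̄R T max@(labels , universal , _)
  with ∃ᵛ? (λ D → suc (card (neighbours (forbids T) D)) ≤? card (lookup D))
... | yes (D , deficient) = deficient-placement T max D deficient
... | no none = ⊥-elim (hall⇒no-node T labels universal (λ D _ → ℕₚ.≤-pred (ℕₚ.≰⇒> (λ h → none (D , h)))))

isLabelR̄R⇒labelR̄R : (S : Subset (2 ^ (2 ^ Δ))) → IsLabelR̄ (R (Π Δ (suc (suc r)))) S → S ≡ labelR̄R (decode {Δ} S)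
isLabelR̄R⇒labelR̄R S (T , max , i , Ti≡S) =
  let (C , _ , T≡) = maximal-node-labelR̄R T max
      S≡ : S ≡ labelR̄R (C i)
      S≡ = trans (sym Ti≡S) (T≡ i)
  in trans S≡ (cong labelR̄R (sym (trans (cong decode S≡) (decode-labelR̄R (C i)))))

labelR̄R-isLabelR̄ : (y : Subset (suc (suc Δ))) → IsLabelR̄ (R (Π (suc (suc Δ)) (suc (suc r)))) (labelR̄R y)
labelR̄R-isLabelR̄ {Δ} {r} y with nonempty? y
... | yes (c , c∈y) = labelR̄R ∘ place y sl , labelR̄R-node-maximal (place y sl) node , zero , refl
  where
  sl : Fin (suc (suc Δ)) → Bool
  sl = select (λ _ → true) (suc (suc (suc Δ) ∸ ∣ y ∣))
  node : Node (Π (suc (suc Δ)) (suc (suc r))) (place y sl)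
  node = place-node {r = suc (suc r)} y (c , lookup⇒∈ c∈y) sl (trans
    (card-select (λ _ → true) _ (subst (suc (suc (suc Δ) ∸ ∣ y ∣) ≤_) (sym card-const-true)
      (ℕₚ.≤-trans (s≤s (ℕₚ.∸-monoʳ-≤ (suc (suc Δ)) (nonempty⇒∣∣≥1 y (c , lookup⇒∈ c∈y)))) ℕₚ.≤-refl)))
    (ℕₚ.+-comm 1 _))
... | no empty = labelR̄R ∘ place ⊤ sl , labelR̄R-node-maximal (place ⊤ sl) node , suc zero , cong labelR̄R (sym y≡⊥)
  where
  y≡⊥ : y ≡ ⊥
  y≡⊥ = lookup-ext y ⊥ (λ c → trans (Boolₚ.¬-not (λ c∈y → empty (c , c∈y))) (sym (lookup-⊥ c)))
  sl : Fin (suc (suc Δ)) → Bool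
  sl j = j =ᶠ zero
  node : Node (Π (suc (suc Δ)) (suc (suc r))) (place ⊤ sl)
  node = place-node {r = suc (suc r)} ⊤ (zero , Subsetₚ.∈⊤) sl (trans (card-at {suc (suc Δ)} (λ _ → true) zero)
    (sym (cong (_+ 1) (trans (cong (suc (suc Δ) ∸_) (Subsetₚ.∣⊤∣≡n (suc (suc Δ)))) (ℕₚ.n∸n≡0 (suc (suc Δ)))))))

MaxUniversal-cong : {Δ r : ℕ} (P : Problem Δ r) {n : ℕ} (C : (Fin n → Vec Bool (k P)) → Set)
                    (T T′ : Fin n → Subset (2 ^ k P)) → (∀ j → T j ≡ T′ j) → MaxUniversal P C T → MaxUniversal P C T′
MaxUniversal-cong P C T T′ T≡T′ (labels , universal , maximal) =
  (λ j → subst (LabelSet P) (T≡T′ j) (labels j)) ,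
  (λ c c∈ → universal c (λ j → subst (_∈ₛ_ {k P} (c j)) (sym (T≡T′ j)) (c∈ j))) ,
  (λ T″ labels″ universal″ ⊇ j →
    trans (maximal T″ labels″ universal″ (λ j x x∈ → ⊇ j x (subst (_∈ₛ_ {k P} x) (T≡T′ j) x∈)) j) (T≡T′ j))

node-cong : (C C′ : Fin Δ → Subset Δ) → (∀ j → C j ≡ C′ j) → Node (Π Δ r) C → Node (Π Δ r) C′
node-cong C C′ C≡C′ (D , nonempty , countD , count⊥) =
  D , nonempty , trans (sym (same-count D)) countD , trans (sym (same-count ⊥)) count⊥
  where
  same-count : ∀ E → countΠ E C ≡ countΠ E C′
  same-count E = trans (countΠ≡card E C) (trans (card-cong (λ j → cong (_== E) (C≡C′ j))) (sym (countΠ≡card E C′)))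

node-decode : (c : Fin Δ → Subset (2 ^ (2 ^ Δ))) → ((i : Fin Δ) → IsLabelR̄ (R (Π Δ (suc (suc r)))) (c i)) →
              MaxUniversal (R (Π Δ (suc (suc r)))) (Node (R (Π Δ (suc (suc r))))) c ⇔ Node (Π Δ (suc (suc r))) (decode {Δ} ∘ c)
node-decode {Δ} {r} c labels = mk⇔ to from
  where
  to : MaxUniversal (R (Π Δ (suc (suc r)))) (Node (R (Π Δ (suc (suc r))))) c → Node (Π Δ (suc (suc r))) (decode {Δ} ∘ c)
  to max = let (C , node , c≡) = maximal-node-labelR̄R c max in
    node-cong {r = suc (suc r)} C (decode {Δ} ∘ c) (λ j → sym (trans (cong (decode {Δ}) (c≡ j)) (decode-labelR̄R (C j)))) node
  from : Node (Π Δ (suc (suc r))) (decode {Δ} ∘ c) → MaxUniversal (R (Π Δ (suc (suc r)))) (Node (R (Π Δ (suc (suc r))))) c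
  from node = MaxUniversal-cong (R (Π Δ (suc (suc r)))) (Node (R (Π Δ (suc (suc r))))) (labelR̄R ∘ decode {Δ} ∘ c) c
    (λ j → sym (isLabelR̄R⇒labelR̄R (c j) (labels j))) (labelR̄R-node-maximal (decode {Δ} ∘ c) node)

-- Chosen sets labelR X_j with X_j ∩ decode (c j) = ∅ contain ∁ X_j; the hyperedge constraint of R(Π)
-- then makes each colour i lie in some X_j, so i ∉ decode (c j).
edge-decode : {Δ r : ℕ} (c : Fin (suc (suc r)) → Subset (2 ^ (2 ^ Δ))) → ((j : Fin (suc (suc r))) → IsLabelR̄ (R (Π Δ (suc (suc r)))) (c j)) →
              Edge (R̄ (R (Π Δ (suc (suc r))))) c ⇔ Edge (Π Δ (suc (suc r))) (decode {Δ} ∘ c)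
edge-decode {Δ} {r} c labels = mk⇔ to from
  where
  c≡ : ∀ j → c j ≡ labelR̄R (decode {Δ} (c j))
  c≡ j = isLabelR̄R⇒labelR̄R (c j) (labels j)
  to : Edge (R̄ (R (Π Δ (suc (suc r))))) c → Edge (Π Δ (suc (suc r))) (decode {Δ} ∘ c)
  to (_ , ch , ch∈ , max) i = j , λ i∈ → true≡false-elim (trans (sym (∈⇒lookup i∈))
      (disjoint-elim (X j) (decode {Δ} (c j)) i (proj₂ (fits j)) i∈X))
    where
    fits : ∀ j → ch j ≡ labelR (forbidden {Δ} (ch j)) × disjoint (forbidden {Δ} (ch j)) (decode {Δ} (c j)) ≡ true
    fits j = ∈ᵇ-labelR̄R⇒ (decode {Δ} (c j)) (ch j) (subst (λ S → ch j ∈ᵇ S ≡ true) (c≡ j) (∈⇒lookup (ch∈ j)))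
    X : Fin (suc (suc r)) → Subset Δ
    X j = forbidden {Δ} (ch j)
    ∁X∈ : ∀ j → ∁ (X j) ∈ₛ ch j
    ∁X∈ j = lookup⇒∈ (trans (cong (∁ (X j) ∈ᵇ_) (proj₁ (fits j))) (trans (∈ᵇ-labelR (X j) (∁ (X j))) (disjoint-∁ (X j))))
    missing = proj₁ (proj₂ max) (λ j → ∁ (X j)) ∁X∈ i
    j = proj₁ missing
    i∈X : lookup (X j) i ≡ true
    i∈X = not≡false (Boolₚ.¬-not (λ e → proj₂ missing (lookup⇒∈ (trans (lookup-∁ (X j) i) e))))
  from : Edge (Π Δ (suc (suc r))) (decode {Δ} ∘ c) → Edge (R̄ (R (Π Δ (suc (suc r))))) c
  from edge = labels , (λ j → labelR (fibre h j)) , fibre∈ , fibres-maximal h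
    where
    h : Fin Δ → Fin (suc (suc r))
    h i = proj₁ (edge i)
    fibre∈ : ∀ j → labelR (fibre h j) ∈ₛ c j
    fibre∈ j = subst (labelR (fibre h j) ∈ₛ_) (sym (c≡ j)) (lookup⇒∈ (∈ᵇ-labelR̄R (decode {Δ} (c j)) (fibre h j)
      (disjoint-intro (fibre h j) (decode {Δ} (c j)) λ i i∈ →
        Boolₚ.¬-not (λ i∈c → proj₂ (edge i) (subst (λ x → i ∈ decode {Δ} (c x)) (sym (=ᶠ⇒≡ (h i) j (trans (sym (lookup-fibre h j i)) i∈)))
          (lookup⇒∈ i∈c))))))

R̄RΠ≅Π : R̄ (R (Π (suc (suc Δ)) (suc (suc r)))) ≅ₚ Π (suc (suc Δ)) (suc (suc r))
R̄RΠ≅Π = record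
  { f = decode
  ; f-lab = λ _ _ → tt
  ; f-inj = λ x y x-label y-label x≡y → trans (isLabelR̄R⇒labelR̄R x x-label)
              (trans (cong labelR̄R x≡y) (sym (isLabelR̄R⇒labelR̄R y y-label)))
  ; f-surj = λ y _ → labelR̄R y , labelR̄R-isLabelR̄ y , decode-labelR̄R y
  ; P-node-lab = λ c node i → c , node , i , refl
  ; Q-node-lab = λ _ _ _ → tt
  ; P-edge-lab = λ c edge j → proj₁ edge j
  ; Q-edge-lab = λ _ _ _ → tt
  ; f-node = node-decode
  ; f-edge = edge-decode
  }

lemma11 : (Δ r : ℕ) → 2 ≤ Δ → 2 ≤ r → R̄ (R (Π Δ r)) ≅ₚ Π Δ r
lemma11 (suc (suc Δ)) (suc (suc r)) _ _ = R̄RΠ≅Π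
lemma11 zero _ () _
lemma11 (suc zero) _ (s≤s ()) _
lemma11 (suc (suc _)) zero _ ()
lemma11 (suc (suc _)) (suc zero) _ (s≤s ())
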